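{- Let $j_1$ be the marked mesh pattern $(32451;\ \text{shaded } \emptyset;\ \text{marked } \{(1,3),(1,4),(1,5)\})$ and $W_2$ the mesh pattern $(3241;\ \text{shaded } \{(1,4)\})$. Let $\pi$ be a permutation and $i_1<\dots<i_5$ an occurrence of $j_1$ in $\pi$, and let $E=\{\pi(i_1),\pi(i_2),\pi(i_3),\pi(i_5)\}$. Then the entries of $E$, at their positions in $S(\pi)$, form an occurrence of $W_2$ in $S(\pi)$ if and only if there exist $k\in\{1,\dots,11\}$ and an occurrence of the pattern $J_{1,k}$ below in $\pi$ in which $\pi(i_1),\dots,\pi(i_5)$ play, in order, the roles of the non-circled entries of $J_{1,k}$. Each pattern is given as (underlying permutation; positions of circled entries; shaded boxes; decreasing region): $J_{1,1}=(342561;\ \{2\};\ \{(1,3),(1,4),(1,5),(1,6),(2,5),(2,6)\};\ \emptyset)$; $J_{1,2}=(3462571;\ \{2,3\};\ \{(0,5),(1,3),(1,4),(1,5),(1,6),(1,7),(2,5),(2,6),(2,7),(3,6),(3,7)\};\ \{(3,5)\})$; $J_{1,3}=(73462581;\ \{1,3,4\};\ T;\ \{(4,5)\})$ and $J_{1,4}=(83462571;\ \{1,3,4\};\ T;\ \{(4,5)\})$, where $T=\{(1,5),(1,6),(1,7),(1,8),(2,3),(2,4),(2,5),(2,6),(2,7),(2,8),(3,5),(3,6),(3,7),(3,8),(4,6),(4,7),(4,8)\}$; $J_{1,5}=(3472561;\ \{2,3\};\ \{(0,5),(0,6),(1,3),(1,4),(1,5),(1,6),(1,7),(2,5),(2,6),(2,7),(3,7)\};\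 \{(3,5),(3,6)\})$; $J_{1,6}=(83472561;\ \{1,3,4\};\ \{(1,5),(1,6),(1,7),(1,8),(2,3),(2,4),(2,5),(2,6),(2,7),(2,8),(3,5),(3,6),(3,7),(3,8),(4,7),(4,8)\};\ \{(4,5),(4,6)\})$; $J_{1,7}=(352461;\ \{2\};\ \{(0,4),(1,3),(1,4),(1,5),(1,6),(2,5),(2,6)\};\ \{(2,4)\})$; $J_{1,8}=(6352471;\ \{1,3\};\ U;\ \{(3,4)\})$ and $J_{1,9}=(7352461;\ \{1,3\};\ U;\ \{(3,4)\})$, where $U=\{(1,4),(1,5),(1,6),(1,7),(2,3),(2,4),(2,5),(2,6),(2,7),(3,5),(3,6),(3,7)\}$; $J_{1,10}=(362451;\ \{2\};\ \{(0,4),(0,5),(1,3),(1,4),(1,5),(1,6),(2,6)\};\ \{(2,4),(2,5)\})$; $J_{1,11}=(7362451;\ \{1,3\};\ \{(1,4),(1,5),(1,6),(1,7),(2,3),(2,4),(2,5),(2,6),(2,7),(3,6),(3,7)\};\ \{(3,4),(3,5)\})$.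
   Context: Permutations are written in one-line notation. The stack-sort operator $S$ is defined by $S(\varepsilon)=\varepsilon$ and, if $\pi=\alpha\, m\,\beta$ with $m$ the largest entry, $S(\pi)=S(\alpha)S(\beta)m$. An occurrence of a classical pattern $p\in S_k$ in $\pi\in S_n$ is a sequence of indices $i_1<\dots<i_k$ with $\pi(i_a)<\pi(i_b)\iff p(a)<p(b)$; the entry $\pi(i_a)$ plays the role of the entry of $p$ at position $a$. For an occurrence put $i_0=0$, $i_{k+1}=n+1$, let $v_0=0$, $v_1<\dots<v_k$ the occurrence values sorted, $v_{k+1}=n+1$; box $(a,b)\in\{0,\dots,k\}^2$ corresponds to the entries $\pi(t)$ with $i_a<t<i_{a+1}$ and $v_b<\pi(t)<v_{b+1}$. A marked mesh pattern $(p;\ \text{shaded } R;\ \text{marked } M)$ occurs if some occurrence of $p$ has every box of $R$ corresponding to the empty set and at least one entry in the union of the boxes of $M$. For a decorated pattern (underlying $p$; circled positions; shaded set $R$; decreasing region $D$), an occurrence is an occurrence of $p$ such that every box in $R$ corresponds to the empty set and the entries of $\pi$ in the union of the boxes of $D$ form a decreasing sequence from left to right (avoid $12$); the circled positions only indicate which entries are not part of the given occurrence of $j_1$. -}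

module Defs where

open import Data.Nat using (ℕ; zero; suc; _+_; _∸_; _<_; _≤_; _⊔_; _≡ᵇ_; _≤ᵇ_)
open import Data.Bool using (Bool; true; false; if_then_else_)
open import Data.List using (List; []; _∷_; _++_; [_]; length; map)
open import Data.Bool.ListAction using (any)
open import Data.List.Relation.Unary.Any using (Any)
open import Data.Product using (_×_; _,_; ∃)
open import Relation.Nullary using (¬_)
open import Relation.Binary.PropositionalEquality using (_≡_)
open import Function.Bundles using (_⇔_)

-- Lists of naturals; permutations in one-line notation are lists
-- containing each of 1,…,n exactly once.

-- 0-based lookup with default 0
nth : List ℕ → ℕ → ℕ
nth []       _       = 0
nth (x ∷ xs) zero    = x
nth (x ∷ xs) (suc i) = nth xs i

-- 1-based lookup: at π t = π(t)
at : List ℕ → ℕ → ℕ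
at π t = nth π (t ∸ 1)

-- Stack sort: S(ε) = ε, S(α m β) = S(α) S(β) m with m the largest entry.

maxL : List ℕ → ℕ
maxL []       = 0
maxL (x ∷ xs) = x ⊔ maxL xs

splitAt : ℕ → List ℕ → List ℕ × List ℕ
splitAt m [] = [] , []
splitAt m (x ∷ xs) with x ≡ᵇ m
... | true  = [] , xs
... | false with splitAt m xs
...   | (a , b) = x ∷ a , b

-- fuel-bounded version (fuel = length suffices since α, β are shorter)
S′ : ℕ → List ℕ → List ℕ
S′ zero    _        = []
S′ (suc f) []       = []
S′ (suc f) (x ∷ xs) with splitAt (maxL (x ∷ xs)) (x ∷ xs)
... | (α , β) = S′ f α ++ S′ f β ++ [ maxL (x ∷ xs) ]

S : List ℕ → List ℕ
S π = S′ (length π) π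

insert : ℕ → List ℕ → List ℕ
insert x [] = [ x ]
insert x (y ∷ ys) = if x ≤ᵇ y then x ∷ y ∷ ys else y ∷ insert x ys

isort : List ℕ → List ℕ
isort []       = []
isort (x ∷ xs) = insert x (isort xs)

-- Occurrences of a classical pattern p in π.  An occurrence is the list
-- `is` = [i_1,…,i_k] of (1-based) positions.

record Occ (p π is : List ℕ) : Set where
  field
    len  : length is ≡ length p
    incr : ∀ a b → a < b → b < length is → nth is a < nth is b
    pos1 : ∀ a → a < length is → 1 ≤ nth is a
    posn : ∀ a → a < length is → nth is a ≤ length π
    iso  : ∀ a b → a < length is → b < length is →
           (at π (nth is a) < at π (nth is b)) ⇔ (nth p a < nth p b)

-- i_0 = 0, i_1,…,i_k, i_{k+1} = n+1
idxs : List ℕ → List ℕ → List ℕ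
idxs π is = 0 ∷ is ++ [ suc (length π) ]

-- v_0 = 0, v_1 < … < v_k the sorted occurrence values, v_{k+1} = n+1
vals : List ℕ → List ℕ → List ℕ
vals π is = 0 ∷ isort (map (at π) is) ++ [ suc (length π) ]

Box : Set
Box = ℕ × ℕ

InBox : List ℕ → List ℕ → Box → ℕ → Set
InBox π is (a , b) t =
  (nth (idxs π is) a < t) × (t < nth (idxs π is) (suc a)) ×
  (nth (vals π is) b < at π t) × (at π t < nth (vals π is) (suc b))

InUnion : List ℕ → List ℕ → List Box → ℕ → Set
InUnion π is R t = Any (λ ab → InBox π is ab t) R

Empty : List ℕ → List ℕ → List Box → Set
Empty π is R = ∀ t → ¬ InUnion π is R t

MarkedMeshOcc : List ℕ → List Box → List Box → List ℕ → List ℕ → Set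
MarkedMeshOcc p R M π is =
  Occ p π is × Empty π is R × ∃ (λ t → InUnion π is M t)

MeshOcc : List ℕ → List Box → List ℕ → List ℕ → Set
MeshOcc p R π is = Occ p π is × Empty π is R

record DecPat : Set where
  constructor decpat
  field
    under   : List ℕ
    circled : List ℕ     -- 1-based positions of circled entries
    shaded  : List Box
    decr    : List Box

open DecPat public

Decreasing : List ℕ → List ℕ → List Box → Set
Decreasing π is D = ∀ t t′ → t < t′ → InUnion π is D t → InUnion π is D t′ →
                    at π t′ < at π t

DecOcc : DecPat → List ℕ → List ℕ → Set
DecOcc J π is = Occ (under J) π is × Empty π is (shaded J) × Decreasing π is (decr J)

nonCircledFrom : ℕ → List ℕ → List ℕ → List ℕ
nonCircledFrom a c []       = []
nonCircledFrom a c (x ∷ xs) =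
  if any (a ≡ᵇ_) c then nonCircledFrom (suc a) c xs
                   else x ∷ nonCircledFrom (suc a) c xs

nonCircled : DecPat → List ℕ → List ℕ
nonCircled J xs = nonCircledFrom 1 (circled J) xs

j1 : List ℕ
j1 = 3 ∷ 2 ∷ 4 ∷ 5 ∷ 1 ∷ []

j1shaded : List Box
j1shaded = []

j1marked : List Box
j1marked = (1 , 3) ∷ (1 , 4) ∷ (1 , 5) ∷ []

W2 : List ℕ
W2 = 3 ∷ 2 ∷ 4 ∷ 1 ∷ []

W2shaded : List Box
W2shaded = (1 , 4) ∷ []

T : List Box
T = (1 , 5) ∷ (1 , 6) ∷ (1 , 7) ∷ (1 , 8) ∷ (2 , 3) ∷ (2 , 4) ∷ (2 , 5) ∷ (2 , 6) ∷
    (2 , 7) ∷ (2 , 8) ∷ (3 , 5) ∷ (3 , 6) ∷ (3 , 7) ∷ (3 , 8) ∷ (4 , 6) ∷ (4 , 7) ∷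
    (4 , 8) ∷ []

U : List Box
U = (1 , 4) ∷ (1 , 5) ∷ (1 , 6) ∷ (1 , 7) ∷ (2 , 3) ∷ (2 , 4) ∷ (2 , 5) ∷ (2 , 6) ∷
    (2 , 7) ∷ (3 , 5) ∷ (3 , 6) ∷ (3 , 7) ∷ []

J11 J12 J13 J14 J15 J16 J17 J18 J19 J110 J111 : DecPat
J11 = decpat (3 ∷ 4 ∷ 2 ∷ 5 ∷ 6 ∷ 1 ∷ []) (2 ∷ [])
        ((1 , 3) ∷ (1 , 4) ∷ (1 , 5) ∷ (1 , 6) ∷ (2 , 5) ∷ (2 , 6) ∷ []) []
J12 = decpat (3 ∷ 4 ∷ 6 ∷ 2 ∷ 5 ∷ 7 ∷ 1 ∷ []) (2 ∷ 3 ∷ [])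
        ((0 , 5) ∷ (1 , 3) ∷ (1 , 4) ∷ (1 , 5) ∷ (1 , 6) ∷ (1 , 7) ∷ (2 , 5) ∷ (2 , 6) ∷
         (2 , 7) ∷ (3 , 6) ∷ (3 , 7) ∷ [])
        ((3 , 5) ∷ [])
J13 = decpat (7 ∷ 3 ∷ 4 ∷ 6 ∷ 2 ∷ 5 ∷ 8 ∷ 1 ∷ []) (1 ∷ 3 ∷ 4 ∷ []) T ((4 , 5) ∷ [])
J14 = decpat (8 ∷ 3 ∷ 4 ∷ 6 ∷ 2 ∷ 5 ∷ 7 ∷ 1 ∷ []) (1 ∷ 3 ∷ 4 ∷ []) T ((4 , 5) ∷ [])
J15 = decpat (3 ∷ 4 ∷ 7 ∷ 2 ∷ 5 ∷ 6 ∷ 1 ∷ []) (2 ∷ 3 ∷ [])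
        ((0 , 5) ∷ (0 , 6) ∷ (1 , 3) ∷ (1 , 4) ∷ (1 , 5) ∷ (1 , 6) ∷ (1 , 7) ∷ (2 , 5) ∷
         (2 , 6) ∷ (2 , 7) ∷ (3 , 7) ∷ [])
        ((3 , 5) ∷ (3 , 6) ∷ [])
J16 = decpat (8 ∷ 3 ∷ 4 ∷ 7 ∷ 2 ∷ 5 ∷ 6 ∷ 1 ∷ []) (1 ∷ 3 ∷ 4 ∷ [])
        ((1 , 5) ∷ (1 , 6) ∷ (1 , 7) ∷ (1 , 8) ∷ (2 , 3) ∷ (2 , 4) ∷ (2 , 5) ∷ (2 , 6) ∷
         (2 , 7) ∷ (2 , 8) ∷ (3 , 5) ∷ (3 , 6) ∷ (3 , 7) ∷ (3 , 8) ∷ (4 , 7) ∷ (4 , 8) ∷ [])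
        ((4 , 5) ∷ (4 , 6) ∷ [])
J17 = decpat (3 ∷ 5 ∷ 2 ∷ 4 ∷ 6 ∷ 1 ∷ []) (2 ∷ [])
        ((0 , 4) ∷ (1 , 3) ∷ (1 , 4) ∷ (1 , 5) ∷ (1 , 6) ∷ (2 , 5) ∷ (2 , 6) ∷ [])
        ((2 , 4) ∷ [])
J18 = decpat (6 ∷ 3 ∷ 5 ∷ 2 ∷ 4 ∷ 7 ∷ 1 ∷ []) (1 ∷ 3 ∷ []) U ((3 , 4) ∷ [])
J19 = decpat (7 ∷ 3 ∷ 5 ∷ 2 ∷ 4 ∷ 6 ∷ 1 ∷ []) (1 ∷ 3 ∷ []) U ((3 , 4) ∷ [])
J110 = decpat (3 ∷ 6 ∷ 2 ∷ 4 ∷ 5 ∷ 1 ∷ []) (2 ∷ [])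
        ((0 , 4) ∷ (0 , 5) ∷ (1 , 3) ∷ (1 , 4) ∷ (1 , 5) ∷ (1 , 6) ∷ (2 , 6) ∷ [])
        ((2 , 4) ∷ (2 , 5) ∷ [])
J111 = decpat (7 ∷ 3 ∷ 6 ∷ 2 ∷ 4 ∷ 5 ∷ 1 ∷ []) (1 ∷ 3 ∷ [])
        ((1 , 4) ∷ (1 , 5) ∷ (1 , 6) ∷ (1 , 7) ∷ (2 , 3) ∷ (2 , 4) ∷ (2 , 5) ∷ (2 , 6) ∷
         (2 , 7) ∷ (3 , 6) ∷ (3 , 7) ∷ [])
        ((3 , 4) ∷ (3 , 5) ∷ [])

J1 : ℕ → DecPat
J1 1  = J11
J1 2  = J12
J1 3  = J13
J1 4  = J14
J1 5  = J15
J1 6  = J16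
J1 7  = J17
J1 8  = J18
J1 9  = J19
J1 10 = J110
J1 _  = J111

E : List ℕ → List ℕ → List ℕ
E π is = at π (nth is 0) ∷ at π (nth is 1) ∷ at π (nth is 2) ∷ at π (nth is 4) ∷ []

-- Write a, b, c, d, e for the entries π(i₁), …, π(i₅), so e < b < a < c < d.
-- In S(π), a precedes b (the marked entry above a lies between them), b precedes c,
-- and c precedes e (d lies between them); hence E forms the mesh pattern W₂ exactly
-- when no entry above c lands between a and b in S(π).  Reading off the stack
-- mechanics, such an entry p exists iff either p lies between i₁ and i₂ and is
-- followed there by a larger entry, or p lies left of i₁, exceeds everything up to
-- i₁, and is exceeded by some entry between i₁ and i₂.  The absence of both is what
-- the J₁,ₖ encode: each occurrence of a J₁,ₖ forces the entries between i₁ and i₂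
-- either to stay below c, or to have a first entry w above c after which everything
-- is below w and the entries above c decrease; conversely the first entry above a
-- after i₁, the first entry above c after it, the last entry above c before i₁, and
-- their comparisons with d determine which J₁,ₖ occurs.

module Submission where

open import Defs
open import Data.Bool using (true; false; if_then_else_) renaming (T to True)
open import Data.Bool.ListAction using (any)
open import Data.Empty using (⊥; ⊥-elim)
open import Data.List using (List; []; _∷_; _++_; [_]; length; map; upTo)
open import Data.List.Properties using (length-++; length-map; ∷-injective)
open import Data.List.Membership.Propositional using (_∈_)
open import Data.List.Membership.Propositional.Properties
  using (∈-++⁺ˡ; ∈-++⁺ʳ; ∈-++⁻; ∈-map⁺; ∈-map⁻; ∈-upTo⁺; ∈-upTo⁻)
open import Data.List.Relation.Binary.Permutation.Propositional
  using (_↭_; ↭-refl; ↭-sym; ↭-trans; ↭-reflexive; prep; swap; ↭⇒↭ₛ)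
open import Data.List.Relation.Binary.Permutation.Propositional.Properties using (++⁺; ++⁺ˡ; ∈-resp-↭; ↭-length)
import Data.List.Relation.Binary.Permutation.Setoid.Properties as Setoid↭
open import Data.List.Relation.Unary.All using (All; []; _∷_; all?)
import Data.List.Relation.Unary.All as All
import Data.List.Relation.Unary.All.Properties as All
open import Data.List.Relation.Unary.AllPairs using (AllPairs; []; _∷_)
open import Data.List.Relation.Unary.Any using (Any; here; there; any?)
import Data.List.Relation.Unary.Any as Any
open import Data.List.Relation.Unary.Linked using (Linked; []; [-]; _∷_; linked?)
open import Data.List.Relation.Unary.Linked.Properties using (AllPairs⇒Linked)
open import Data.List.Relation.Unary.Unique.Propositional using (Unique)
import Data.List.Relation.Unary.Unique.Propositional.Properties as Unique
open import Data.Nat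
open import Data.Nat.Properties
open import Data.Product using (_×_; _,_; ∃; ∃₂; proj₁; proj₂; Σ)
open import Data.Product.Properties using (≡-dec)
open import Data.List.Membership.DecPropositional (≡-dec _≟_ _≟_) using (_∈?_)
open import Data.Sum using (_⊎_; inj₁; inj₂)
open import Data.Unit using (tt)
open import Function.Bundles using (_⇔_; mk⇔; Equivalence)
open import Relation.Binary.Definitions using (tri<; tri≈; tri>)
open import Relation.Binary.PropositionalEquality hiding ([_])
open import Relation.Nullary using (¬_; Dec; yes; no)
open import Relation.Nullary.Decidable using (toWitness; _×-dec_) renaming (True to Holds)

nth-∈ : ∀ (l : List ℕ) i → i < length l → nth l i ∈ l
nth-∈ (x ∷ l) zero    _         = here refl
nth-∈ (x ∷ l) (suc i) (s≤s i<) = there (nth-∈ l i i<)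

∈⇒nth : ∀ {x} {l : List ℕ} → x ∈ l → ∃ λ i → i < length l × nth l i ≡ x
∈⇒nth (here refl) = 0 , s≤s z≤n , refl
∈⇒nth (there x∈) with ∈⇒nth x∈
... | i , i< , eq = suc i , s≤s i< , eq

nth-injective : ∀ {l : List ℕ} → Unique l → ∀ i j → i < length l → j < length l →
                nth l i ≡ nth l j → i ≡ j
nth-injective (_ ∷ _) zero zero _ _ _ = refl
nth-injective {_ ∷ l} (x∉ ∷ _) zero (suc j) _ (s≤s j<) eq = ⊥-elim (All.lookup x∉ (nth-∈ l j j<) eq)
nth-injective {_ ∷ l} (x∉ ∷ _) (suc i) zero (s≤s i<) _ eq = ⊥-elim (All.lookup x∉ (nth-∈ l i i<) (sym eq))
nth-injective (_ ∷ u) (suc i) (suc j) (s≤s i<) (s≤s j<) eq = cong suc (nth-injective u i j i< j< eq)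

nth-map : ∀ (g : ℕ → ℕ) (l : List ℕ) i → i < length l → nth (map g l) i ≡ g (nth l i)
nth-map g (x ∷ l) zero    _        = refl
nth-map g (x ∷ l) (suc i) (s≤s i<) = nth-map g l i i<

nth-++ˡ : ∀ (xs ys : List ℕ) i → i < length xs → nth (xs ++ ys) i ≡ nth xs i
nth-++ˡ (x ∷ xs) ys zero    _        = refl
nth-++ˡ (x ∷ xs) ys (suc i) (s≤s i<) = nth-++ˡ xs ys i i<

nth-++-length : ∀ (xs : List ℕ) y → nth (xs ++ [ y ]) (length xs) ≡ y
nth-++-length []       y = refl
nth-++-length (x ∷ xs) y = nth-++-length xs y

nth-beyond : ∀ (l : List ℕ) {i} → length l ≤ i → nth l i ≡ 0
nth-beyond []      _          = refl
nth-beyond (x ∷ l) (s≤s l≤i) = nth-beyond l l≤i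

nth-defined : ∀ (l : List ℕ) {i y} → y < nth l i → i < length l
nth-defined l {i} y< with i <? length l
... | yes i< = i<
... | no i≮  = ⊥-elim (<⇒≱ y< (≤-trans (≤-reflexive (nth-beyond l (≮⇒≥ i≮))) z≤n))

data Before : List ℕ → ℕ → ℕ → Set where
  first : ∀ {u v xs} → v ∈ xs → Before (u ∷ xs) u v
  skip  : ∀ {x u v xs} → Before xs u v → Before (x ∷ xs) u v

-- Between l u v w : w occurs strictly between u and v, which occur in this order
data Between : List ℕ → ℕ → ℕ → ℕ → Set where
  first : ∀ {u v w xs} → Before xs w v → Between (u ∷ xs) u v w
  skip  : ∀ {x u v w xs} → Between xs u v w → Between (x ∷ xs) u v w

nth-before : ∀ (l : List ℕ) i j → i < j → j < length l → Before l (nth l i) (nth l j)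
nth-before (x ∷ l) zero    (suc j) _        (s≤s j<) = first (nth-∈ l j j<)
nth-before (x ∷ l) (suc i) (suc j) (s≤s i<j) (s≤s j<) = skip (nth-before l i j i<j j<)

before⇒nth : ∀ {l u v} → Before l u v →
             ∃₂ λ i j → i < j × j < length l × nth l i ≡ u × nth l j ≡ v
before⇒nth (first v∈) with ∈⇒nth v∈
... | j , j< , eq = 0 , suc j , s≤s z≤n , s≤s j< , refl , eq
before⇒nth (skip b) with before⇒nth b
... | i , j , i<j , j< , eq₁ , eq₂ = suc i , suc j , s≤s i<j , s≤s j< , eq₁ , eq₂

nth-between : ∀ (l : List ℕ) i k j → i < k → k < j → j < length l →
              Between l (nth l i) (nth l j) (nth l k)
nth-between (x ∷ l) zero    (suc k) (suc j) _         (s≤s k<j) (s≤s j<) = first (nth-before l k j k<j j<)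
nth-between (x ∷ l) (suc i) (suc k) (suc j) (s≤s i<k) (s≤s k<j) (s≤s j<) = skip (nth-between l i k j i<k k<j j<)

between⇒nth : ∀ {l u v w} → Between l u v w → Σ ℕ λ i → Σ ℕ λ k → Σ ℕ λ j →
              i < k × k < j × j < length l × nth l i ≡ u × nth l j ≡ v × nth l k ≡ w
between⇒nth (first b) with before⇒nth b
... | k , j , k<j , j< , eq₁ , eq₂ = 0 , suc k , suc j , s≤s z≤n , s≤s k<j , s≤s j< , refl , eq₂ , eq₁
between⇒nth (skip b) with between⇒nth b
... | i , k , j , i<k , k<j , j< , eq₁ , eq₂ , eq₃ =
  suc i , suc k , suc j , s≤s i<k , s≤s k<j , s≤s j< , eq₁ , eq₂ , eq₃

before-∈ : ∀ {l u v} → Before l u v → u ∈ l × v ∈ l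
before-∈ (first v∈) = here refl , there v∈
before-∈ (skip b) with before-∈ b
... | u∈ , v∈ = there u∈ , there v∈

between-∈ : ∀ {l u v w} → Between l u v w → u ∈ l × v ∈ l × w ∈ l
between-∈ (first b) with before-∈ b
... | w∈ , v∈ = here refl , there v∈ , there w∈
between-∈ (skip b) with between-∈ b
... | u∈ , v∈ , w∈ = there u∈ , there v∈ , there w∈

before-asym : ∀ {l u v} → Unique l → Before l u v → Before l v u → ⊥
before-asym {l} U b b′ with before⇒nth b | before⇒nth b′
... | i , j , i<j , j< , eu , ev | i′ , j′ , i′<j′ , j′< , ev′ , eu′ =
  <-asym (subst (_< j) i≡j′ i<j) (subst (_< j′) (sym j≡i′) i′<j′)
  where
  i≡j′ : i ≡ j′
  i≡j′ = nth-injective U i j′ (<-trans i<j j<) j′< (trans eu (sym eu′))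
  j≡i′ : j ≡ i′
  j≡i′ = nth-injective U j i′ j< (<-trans i′<j′ j′<) (trans ev (sym ev′))

before-++ˡ : ∀ {xs} ys {u v} → Before xs u v → Before (xs ++ ys) u v
before-++ˡ ys (first v∈) = first (∈-++⁺ˡ v∈)
before-++ˡ ys (skip b)   = skip (before-++ˡ ys b)

before-++ʳ : ∀ xs {ys u v} → Before ys u v → Before (xs ++ ys) u v
before-++ʳ []       b = b
before-++ʳ (x ∷ xs) b = skip (before-++ʳ xs b)

before-++ : ∀ xs {ys u v} → u ∈ xs → v ∈ ys → Before (xs ++ ys) u v
before-++ (x ∷ xs) (here refl) v∈ = first (∈-++⁺ʳ xs v∈)
before-++ (x ∷ xs) (there u∈)  v∈ = skip (before-++ xs u∈ v∈)

before-++⁻ : ∀ xs {ys u v} → Before (xs ++ ys) u v →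
             Before xs u v ⊎ Before ys u v ⊎ (u ∈ xs × v ∈ ys)
before-++⁻ []       b = inj₂ (inj₁ b)
before-++⁻ (x ∷ xs) (first v∈) with ∈-++⁻ xs v∈
... | inj₁ v∈xs = inj₁ (first v∈xs)
... | inj₂ v∈ys = inj₂ (inj₂ (here refl , v∈ys))
before-++⁻ (x ∷ xs) (skip b) with before-++⁻ xs b
... | inj₁ b′              = inj₁ (skip b′)
... | inj₂ (inj₁ b′)       = inj₂ (inj₁ b′)
... | inj₂ (inj₂ (u∈ , v∈)) = inj₂ (inj₂ (there u∈ , v∈))

between-++ˡ : ∀ {xs} ys {u v w} → Between xs u v w → Between (xs ++ ys) u v w
between-++ˡ ys (first b) = first (before-++ˡ ys b)
between-++ˡ ys (skip b)  = skip (between-++ˡ ys b)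

between-++ʳ : ∀ xs {ys u v w} → Between ys u v w → Between (xs ++ ys) u v w
between-++ʳ []       b = b
between-++ʳ (x ∷ xs) b = skip (between-++ʳ xs b)

between-++⁻ : ∀ xs {ys u v w} → Between (xs ++ ys) u v w →
              Between xs u v w ⊎ Between ys u v w ⊎ (u ∈ xs × v ∈ ys)
between-++⁻ []       b = inj₂ (inj₁ b)
between-++⁻ (x ∷ xs) (first b) with before-++⁻ xs b
... | inj₁ b′              = inj₁ (first b′)
... | inj₂ (inj₁ b′)       = inj₂ (inj₂ (here refl , proj₂ (before-∈ b′)))
... | inj₂ (inj₂ (_ , v∈)) = inj₂ (inj₂ (here refl , v∈))
between-++⁻ (x ∷ xs) (skip b) with between-++⁻ xs b
... | inj₁ b′              = inj₁ (skip b′)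
... | inj₂ (inj₁ b′)       = inj₂ (inj₁ b′)
... | inj₂ (inj₂ (u∈ , v∈)) = inj₂ (inj₂ (there u∈ , v∈))

between-++-∷ : ∀ xs {ys v u} m → v ∈ xs → u ∈ ys → Between (xs ++ m ∷ ys) v u m
between-++-∷ (x ∷ xs) m (here refl) u∈ = first (before-++ʳ xs (first u∈))
between-++-∷ (x ∷ xs) m (there v∈)  u∈ = skip (between-++-∷ xs m v∈ u∈)

Unique-++⁻ˡ : ∀ (xs : List ℕ) {ys} → Unique (xs ++ ys) → Unique xs
Unique-++⁻ˡ []       _         = []
Unique-++⁻ˡ (x ∷ xs) (x∉ ∷ u) = All.++⁻ˡ xs x∉ ∷ Unique-++⁻ˡ xs u

Unique-++⁻ʳ : ∀ (xs : List ℕ) {ys} → Unique (xs ++ ys) → Unique ys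
Unique-++⁻ʳ []       u       = u
Unique-++⁻ʳ (x ∷ xs) (_ ∷ u) = Unique-++⁻ʳ xs u

Unique-++-disjoint : ∀ (xs : List ℕ) {ys} → Unique (xs ++ ys) → ∀ {a} → a ∈ xs → a ∈ ys → ⊥
Unique-++-disjoint (x ∷ xs) (x∉ ∷ _) (here refl) a∈ys = All.lookup x∉ (∈-++⁺ʳ xs a∈ys) refl
Unique-++-disjoint (x ∷ xs) (_ ∷ u)  (there a∈)  a∈ys = Unique-++-disjoint xs u a∈ a∈ys

module _ (xs : List ℕ) {ys : List ℕ} (U : Unique (xs ++ ys)) where

  before-++⁻ˡ : ∀ {u v} → v ∈ xs → Before (xs ++ ys) u v → Before xs u v
  before-++⁻ˡ v∈ b with before-++⁻ xs b
  ... | inj₁ b′              = b′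
  ... | inj₂ (inj₁ b′)       = ⊥-elim (Unique-++-disjoint xs U v∈ (proj₂ (before-∈ b′)))
  ... | inj₂ (inj₂ (_ , v∈ys)) = ⊥-elim (Unique-++-disjoint xs U v∈ v∈ys)

  before-++⁻ʳ : ∀ {u v} → u ∈ ys → Before (xs ++ ys) u v → Before ys u v
  before-++⁻ʳ u∈ b with before-++⁻ xs b
  ... | inj₁ b′              = ⊥-elim (Unique-++-disjoint xs U (proj₁ (before-∈ b′)) u∈)
  ... | inj₂ (inj₁ b′)       = b′
  ... | inj₂ (inj₂ (u∈xs , _)) = ⊥-elim (Unique-++-disjoint xs U u∈xs u∈)

  between-++⁻ˡ : ∀ {u v w} → v ∈ xs → Between (xs ++ ys) u v w → Between xs u v w
  between-++⁻ˡ v∈ b with between-++⁻ xs b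
  ... | inj₁ b′              = b′
  ... | inj₂ (inj₁ b′)       = ⊥-elim (Unique-++-disjoint xs U v∈ (proj₁ (proj₂ (between-∈ b′))))
  ... | inj₂ (inj₂ (_ , v∈ys)) = ⊥-elim (Unique-++-disjoint xs U v∈ v∈ys)

  between-++⁻ʳ : ∀ {u v w} → u ∈ ys → Between (xs ++ ys) u v w → Between ys u v w
  between-++⁻ʳ u∈ b with between-++⁻ xs b
  ... | inj₁ b′              = ⊥-elim (Unique-++-disjoint xs U (proj₁ (between-∈ b′)) u∈)
  ... | inj₂ (inj₁ b′)       = b′
  ... | inj₂ (inj₂ (u∈xs , _)) = ⊥-elim (Unique-++-disjoint xs U u∈xs u∈)

-- Stack sort

maxL-≥ : ∀ {y} (l : List ℕ) → y ∈ l → y ≤ maxL l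
maxL-≥ (x ∷ l) (here refl) = m≤m⊔n x (maxL l)
maxL-≥ (x ∷ l) (there y∈)  = ≤-trans (maxL-≥ l y∈) (m≤n⊔m x (maxL l))

maxL-∈ : ∀ x (l : List ℕ) → maxL (x ∷ l) ∈ x ∷ l
maxL-∈ x []      rewrite ⊔-identityʳ x = here refl
maxL-∈ x (y ∷ l) with ⊔-sel x (maxL (y ∷ l))
... | inj₁ eq rewrite eq = here refl
... | inj₂ eq rewrite eq = there (maxL-∈ y l)

splitAt-++ : ∀ m (l : List ℕ) → m ∈ l → l ≡ proj₁ (splitAt m l) ++ m ∷ proj₂ (splitAt m l)
splitAt-++ m (x ∷ l) m∈ with x ≡ᵇ m in x≡ᵇm
... | true = cong (_∷ l) (≡ᵇ⇒≡ x m (subst True (sym x≡ᵇm) tt))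
... | false with splitAt m l in split | m∈
...   | _ | here refl = ⊥-elim (subst True x≡ᵇm (≡⇒≡ᵇ x x refl))
...   | _ | there m∈l = cong (x ∷_) (trans (splitAt-++ m l m∈l) (cong (λ s → proj₁ s ++ m ∷ proj₂ s) split))

splitAt-max : ∀ x xs {α β} → splitAt (maxL (x ∷ xs)) (x ∷ xs) ≡ (α , β) →
              x ∷ xs ≡ α ++ maxL (x ∷ xs) ∷ β
splitAt-max x xs split =
  subst (λ s → x ∷ xs ≡ proj₁ s ++ maxL (x ∷ xs) ∷ proj₂ s) split
        (splitAt-++ (maxL (x ∷ xs)) (x ∷ xs) (maxL-∈ x xs))

length-left : ∀ {f} (α : List ℕ) m β → length (α ++ m ∷ β) ≤ suc f → length α ≤ f
length-left α m β le rewrite length-++ α {m ∷ β} | +-suc (length α) (length β) =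
  ≤-trans (m≤m+n (length α) (length β)) (≤-pred le)

length-right : ∀ {f} (α : List ℕ) m β → length (α ++ m ∷ β) ≤ suc f → length β ≤ f
length-right α m β le rewrite length-++ α {m ∷ β} | +-suc (length α) (length β) =
  ≤-trans (m≤n+m (length β) (length α)) (≤-pred le)

++-[]-↭ : ∀ (m : ℕ) (β : List ℕ) → β ++ [ m ] ↭ m ∷ β
++-[]-↭ m []      = ↭-refl
++-[]-↭ m (b ∷ β) = ↭-trans (prep b (++-[]-↭ m β)) (swap b m ↭-refl)

S′-↭ : ∀ f l → length l ≤ f → S′ f l ↭ l
S′-↭ zero    []       _  = ↭-refl
S′-↭ (suc f) []       _  = ↭-refl
S′-↭ (suc f) (x ∷ xs) le with splitAt (maxL (x ∷ xs)) (x ∷ xs) in split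
... | α , β =
  ↭-trans (++⁺ (S′-↭ f α (length-left α m β le′)) (++⁺ (S′-↭ f β (length-right α m β le′)) ↭-refl))
    (↭-trans (++⁺ˡ α (++-[]-↭ m β)) (subst (α ++ m ∷ β ↭_) (sym eq) ↭-refl))
  where
  m = maxL (x ∷ xs)
  eq = splitAt-max x xs split
  le′ : length (α ++ m ∷ β) ≤ suc f
  le′ = subst (λ l → length l ≤ suc f) eq le

-- Sufficient conditions for u to leave the stack before v.  Either u comes
-- first and is popped before v is pushed (it is smaller than v or than an
-- entry in between), or v comes first and stays below u on the stack.
Precedes : List ℕ → ℕ → ℕ → Set
Precedes l u v = (Before l u v × (u < v ⊎ ∃ λ w → Between l u v w × u < w)) ⊎
                 (Before l v u × u < v × (∀ w → Between l v u w → w < v))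

module _ (xs : List ℕ) {ys : List ℕ} (U : Unique (xs ++ ys)) where

  Precedes-++⁻ˡ : ∀ {u v} → u ∈ xs → v ∈ xs → Precedes (xs ++ ys) u v → Precedes xs u v
  Precedes-++⁻ˡ u∈ v∈ (inj₁ (b , inj₁ u<v))            = inj₁ (before-++⁻ˡ xs U v∈ b , inj₁ u<v)
  Precedes-++⁻ˡ u∈ v∈ (inj₁ (b , inj₂ (w , bw , u<w))) = inj₁ (before-++⁻ˡ xs U v∈ b , inj₂ (w , between-++⁻ˡ xs U v∈ bw , u<w))
  Precedes-++⁻ˡ u∈ v∈ (inj₂ (b , u<v , below))         = inj₂ (before-++⁻ˡ xs U u∈ b , u<v , λ w bw → below w (between-++ˡ ys bw))

  Precedes-++⁻ʳ : ∀ {u v} → u ∈ ys → v ∈ ys → Precedes (xs ++ ys) u v → Precedes ys u v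
  Precedes-++⁻ʳ u∈ v∈ (inj₁ (b , inj₁ u<v))            = inj₁ (before-++⁻ʳ xs U u∈ b , inj₁ u<v)
  Precedes-++⁻ʳ u∈ v∈ (inj₁ (b , inj₂ (w , bw , u<w))) = inj₁ (before-++⁻ʳ xs U u∈ b , inj₂ (w , between-++⁻ʳ xs U u∈ bw , u<w))
  Precedes-++⁻ʳ u∈ v∈ (inj₂ (b , u<v , below))         = inj₂ (before-++⁻ʳ xs U v∈ b , u<v , λ w bw → below w (between-++ʳ xs bw))

∈-++-∷⁻ : ∀ (α : List ℕ) {m β u} → u ∈ α ++ m ∷ β → u ∈ α ⊎ u ≡ m ⊎ u ∈ β
∈-++-∷⁻ α u∈ with ∈-++⁻ α u∈
... | inj₁ u∈α         = inj₁ u∈α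
... | inj₂ (here eq)   = inj₂ (inj₁ eq)
... | inj₂ (there u∈β) = inj₂ (inj₂ u∈β)

-- One step of S(α m β) = S(α) S(β) m, with the two recursive calls abstracted.
Precedes⇒Before-step :
  ∀ (α β : List ℕ) m (Sα Sβ : List ℕ) →
  Unique (α ++ m ∷ β) → (∀ {y} → y ∈ α ++ m ∷ β → y ≤ m) →
  (∀ {u} → u ∈ α → u ∈ Sα) → (∀ {u} → u ∈ β → u ∈ Sβ) →
  (∀ {u v} → u ∈ α → v ∈ α → Precedes α u v → Before Sα u v) →
  (∀ {u v} → u ∈ β → v ∈ β → Precedes β u v → Before Sβ u v) →
  ∀ {u v} → u ∈ α ++ m ∷ β → v ∈ α ++ m ∷ β → Precedes (α ++ m ∷ β) u v →
  Before (Sα ++ Sβ ++ [ m ]) u v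
Precedes⇒Before-step α β m Sα Sβ U ≤m ∈Sα ∈Sβ recα recβ {u} {v} u∈ v∈ p
  with ∈-++-∷⁻ α u∈ | ∈-++-∷⁻ α v∈
... | inj₁ u∈α | inj₁ v∈α = before-++ˡ (Sβ ++ [ m ]) (recα u∈α v∈α (Precedes-++⁻ˡ α U u∈α v∈α p))
... | inj₁ u∈α | inj₂ (inj₁ refl) = before-++ Sα (∈Sα u∈α) (∈-++⁺ʳ Sβ (here refl))
... | inj₁ u∈α | inj₂ (inj₂ v∈β) = before-++ Sα (∈Sα u∈α) (∈-++⁺ˡ (∈Sβ v∈β))
... | inj₂ (inj₁ refl) | _ = ⊥-elim (max-never-precedes p)
  where
  max-never-precedes : Precedes (α ++ u ∷ β) u v → ⊥
  max-never-precedes (inj₁ (_ , inj₁ u<v))            = <⇒≱ u<v (≤m v∈)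
  max-never-precedes (inj₁ (_ , inj₂ (w , bw , u<w))) = <⇒≱ u<w (≤m (proj₂ (proj₂ (between-∈ bw))))
  max-never-precedes (inj₂ (_ , u<v , _))             = <⇒≱ u<v (≤m v∈)
... | inj₂ (inj₂ u∈β) | inj₁ v∈α = ⊥-elim (right-never-precedes-left p)
  where
  right-never-precedes-left : Precedes (α ++ m ∷ β) u v → ⊥
  right-never-precedes-left (inj₁ (b , _))          = before-asym U b (before-++ α v∈α (there u∈β))
  right-never-precedes-left (inj₂ (_ , _ , below)) = <⇒≱ (below m (between-++-∷ α m v∈α u∈β)) (≤m v∈)
... | inj₂ (inj₂ u∈β) | inj₂ (inj₁ refl) = before-++ʳ Sα (before-++ Sβ (∈Sβ u∈β) (here refl))
... | inj₂ (inj₂ u∈β) | inj₂ (inj₂ v∈β) =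
  before-++ʳ Sα (before-++ˡ [ m ] (recβ u∈β v∈β
    (Precedes-++⁻ʳ [ m ] (Unique-++⁻ʳ α U) u∈β v∈β (Precedes-++⁻ʳ α U (there u∈β) (there v∈β) p))))

Precedes⇒Before-S′ : ∀ f l → length l ≤ f → Unique l → ∀ {u v} → u ∈ l → v ∈ l →
                     Precedes l u v → Before (S′ f l) u v
Precedes⇒Before-S′ (suc f) (x ∷ xs) le U {u} {v} u∈ v∈ p with splitAt (maxL (x ∷ xs)) (x ∷ xs) in split
... | α , β =
  Precedes⇒Before-step α β m (S′ f α) (S′ f β) U′ ≤m
    (∈-resp-↭ (↭-sym (S′-↭ f α α≤))) (∈-resp-↭ (↭-sym (S′-↭ f β β≤)))
    (Precedes⇒Before-S′ f α α≤ (Unique-++⁻ˡ α U′))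
    (Precedes⇒Before-S′ f β β≤ (Unique-++⁻ʳ [ m ] (Unique-++⁻ʳ α U′)))
    (subst (u ∈_) eq u∈) (subst (v ∈_) eq v∈) (subst (λ l → Precedes l u v) eq p)
  where
  m = maxL (x ∷ xs)
  eq = splitAt-max x xs split
  le′ : length (α ++ m ∷ β) ≤ suc f
  le′ = subst (λ l → length l ≤ suc f) eq le
  α≤ = length-left α m β le′
  β≤ = length-right α m β le′
  U′ = subst Unique eq U
  ≤m : ∀ {y} → y ∈ α ++ m ∷ β → y ≤ m
  ≤m y∈ = maxL-≥ (x ∷ xs) (subst (_ ∈_) (sym eq) y∈)

S-↭ : ∀ π → S π ↭ π
S-↭ π = S′-↭ (length π) π ≤-refl

Precedes⇒Before-S : ∀ {π} → Unique π → ∀ {u v} → u ∈ π → v ∈ π → Precedes π u v → Before (S π) u v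
Precedes⇒Before-S {π} = Precedes⇒Before-S′ (length π) π ≤-refl

Ascending : List ℕ → Set
Ascending = Linked _<_

ascending-head : ∀ {x l y} → Ascending (x ∷ l) → y ∈ l → x < y
ascending-head (x<y ∷ _)   (here refl) = x<y
ascending-head (x<y ∷ asc) (there y∈)  = <-trans x<y (ascending-head asc y∈)

ascending-tail : ∀ {x l} → Ascending (x ∷ l) → Ascending l
ascending-tail [-]       = []
ascending-tail (_ ∷ asc) = asc

ascending-nth : ∀ {l} → Ascending l → ∀ {i j} → i < j → j < length l → nth l i < nth l j
ascending-nth {x ∷ l} asc {zero}  {suc j} _         (s≤s j<) = ascending-head asc (nth-∈ l j j<)
ascending-nth {x ∷ l} asc {suc i} {suc j} (s≤s i<j) (s≤s j<) = ascending-nth (ascending-tail asc) i<j j<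

ascending-nth-≤ : ∀ {l} → Ascending l → ∀ {i j} → i ≤ j → j < length l → nth l i ≤ nth l j
ascending-nth-≤ asc i≤j j< with m≤n⇒m<n∨m≡n i≤j
... | inj₁ i<j  = <⇒≤ (ascending-nth asc i<j j<)
... | inj₂ refl = ≤-refl

ascending-head-≡ : ∀ {x xs y ys} → Ascending (x ∷ xs) → Ascending (y ∷ ys) → x ∈ y ∷ ys → y ∈ x ∷ xs → x ≡ y
ascending-head-≡ _  _  (here x≡y) _          = x≡y
ascending-head-≡ _  _  (there _)  (here y≡x) = sym y≡x
ascending-head-≡ ax ay (there x∈) (there y∈) = ⊥-elim (<-asym (ascending-head ay x∈) (ascending-head ax y∈))

ascending-≡ : ∀ {xs ys} → Ascending xs → Ascending ys →
              (∀ {z} → z ∈ xs → z ∈ ys) → (∀ {z} → z ∈ ys → z ∈ xs) → xs ≡ ys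
ascending-≡ {[]}     {[]}     _ _ _ _ = refl
ascending-≡ {[]}     {y ∷ ys} _ _ _ ⊇ with ⊇ (here refl)
... | ()
ascending-≡ {x ∷ xs} {[]}     _ _ ⊆ _ with ⊆ (here refl)
... | ()
ascending-≡ {x ∷ xs} {y ∷ ys} ax ay ⊆ ⊇ with ascending-head-≡ ax ay (⊆ (here refl)) (⊇ (here refl))
... | refl = cong (x ∷_) (ascending-≡ (ascending-tail ax) (ascending-tail ay) ⊆′ ⊇′)
  where
  ⊆′ : ∀ {z} → z ∈ xs → z ∈ ys
  ⊆′ z∈ with ⊆ (there z∈)
  ... | here refl = ⊥-elim (<-irrefl refl (ascending-head ax z∈))
  ... | there z∈′ = z∈′
  ⊇′ : ∀ {z} → z ∈ ys → z ∈ xs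
  ⊇′ z∈ with ⊇ (there z∈)
  ... | here refl = ⊥-elim (<-irrefl refl (ascending-head ay z∈))
  ... | there z∈′ = z∈′

ascending-++⁻ˡ : ∀ xs {ys} → Ascending (xs ++ ys) → Ascending xs
ascending-++⁻ˡ []           _         = []
ascending-++⁻ˡ (x ∷ [])     _         = [-]
ascending-++⁻ˡ (x ∷ y ∷ xs) (x<y ∷ asc) = x<y ∷ ascending-++⁻ˡ (y ∷ xs) asc

ascending-++-[] : ∀ {l hi} → Ascending l → All (_< hi) l → Ascending (l ++ [ hi ])
ascending-++-[] []          []           = [-]
ascending-++-[] [-]         (x<hi ∷ [])  = x<hi ∷ [-]
ascending-++-[] (x<y ∷ asc) (_ ∷ <hi)    = x<y ∷ ascending-++-[] asc <hi

locate : ∀ {V} → Ascending V → ∀ {y} lo hi → lo < hi → hi < length V →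
         nth V lo < y → y < nth V hi → (∀ m → m < length V → y ≢ nth V m) →
         ∃ λ b → lo ≤ b × b < hi × nth V b < y × y < nth V (suc b)
locate {V} asc {y} lo (suc h) lo<hi hi< lo<y y<hi ≢V with <-cmp lo h
... | tri≈ _ refl _ = lo , ≤-refl , ≤-refl , lo<y , y<hi
... | tri> _ _ h<lo = ⊥-elim (<⇒≱ h<lo (≤-pred lo<hi))
... | tri< lo<h _ _ with <-cmp y (nth V h)
...   | tri≈ _ y≡ _ = ⊥-elim (≢V h (<-trans ≤-refl hi<) y≡)
...   | tri> _ _ h<y = h , <⇒≤ lo<h , ≤-refl , h<y , y<hi
...   | tri< y<h _ _ with locate asc lo h lo<h (<-trans ≤-refl hi<) lo<y y<h ≢V
...     | b , lo≤b , b<h , b<y , y<b+1 = b , lo≤b , m<n⇒m<1+n b<h , b<y , y<b+1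

nth⇒All : ∀ {P : ℕ → Set} (l : List ℕ) → (∀ j → j < length l → P (nth l j)) → All P l
nth⇒All []      _     = []
nth⇒All (y ∷ l) P-nth = P-nth 0 (s≤s z≤n) ∷ nth⇒All l (λ j j< → P-nth (suc j) (s≤s j<))

nth⇒AllPairs : ∀ {R : ℕ → ℕ → Set} l →
               (∀ i j → i < j → j < length l → R (nth l i) (nth l j)) → AllPairs R l
nth⇒AllPairs []      _ = []
nth⇒AllPairs (x ∷ l) R-nth =
  nth⇒All l (λ j j< → R-nth 0 (suc j) (s≤s z≤n) (s≤s j<)) ∷
  nth⇒AllPairs l (λ i j i<j j< → R-nth (suc i) (suc j) (s≤s i<j) (s≤s j<))

ascending-from-nth : ∀ l → (∀ i j → i < j → j < length l → nth l i < nth l j) → Ascending l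
ascending-from-nth l <-nth = AllPairs⇒Linked (nth⇒AllPairs l <-nth)

insert-∈⁻ : ∀ {x y} (l : List ℕ) → y ∈ insert x l → y ≡ x ⊎ y ∈ l
insert-∈⁻ []      (here eq) = inj₁ eq
insert-∈⁻ {x} (z ∷ l) y∈ with x ≤ᵇ z
insert-∈⁻ (z ∷ l) (here eq)  | true  = inj₁ eq
insert-∈⁻ (z ∷ l) (there y∈) | true  = inj₂ y∈
insert-∈⁻ (z ∷ l) (here eq)  | false = inj₂ (here eq)
insert-∈⁻ (z ∷ l) (there y∈) | false with insert-∈⁻ l y∈
... | inj₁ eq  = inj₁ eq
... | inj₂ y∈l = inj₂ (there y∈l)

isort-∈⁻ : ∀ {y} (l : List ℕ) → y ∈ isort l → y ∈ l
isort-∈⁻ (x ∷ l) y∈ with insert-∈⁻ (isort l) y∈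
... | inj₁ eq = here eq
... | inj₂ y∈ = there (isort-∈⁻ l y∈)

length-insert : ∀ x (l : List ℕ) → length (insert x l) ≡ suc (length l)
length-insert x []      = refl
length-insert x (y ∷ l) with x ≤ᵇ y
... | true  = refl
... | false = cong suc (length-insert x l)

length-isort : ∀ (l : List ℕ) → length (isort l) ≡ length l
length-isort []      = refl
length-isort (x ∷ l) = trans (length-insert x (isort l)) (cong suc (length-isort l))

module _ (h : ℕ → ℕ) (G : ℕ → Set) (monotone : ∀ {x y} → G x → G y → (x ≤ᵇ y) ≡ (h x ≤ᵇ h y)) where

  insert-map : ∀ {x} (l : List ℕ) → G x → All G l → insert (h x) (map h l) ≡ map h (insert x l)
  insert-map []      _  _          = refl
  insert-map {x} (y ∷ l) gx (gy ∷ gl) rewrite sym (monotone gx gy) with x ≤ᵇ y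
  ... | true  = refl
  ... | false = cong (h y ∷_) (insert-map l gx gl)

  isort-map : ∀ (l : List ℕ) → All G l → isort (map h l) ≡ map h (isort l)
  isort-map []      _          = refl
  isort-map (x ∷ l) (gx ∷ gl) rewrite isort-map l gl =
    insert-map (isort l) gx (All.tabulate (λ y∈ → All.lookup gl (isort-∈⁻ l y∈)))

InRange : ℕ → ℕ → Set
InRange n t = 1 ≤ t × t ≤ n

inRange? : ∀ n t → Dec (InRange n t)
inRange? n t = (1 ≤? t) ×-dec (t ≤? n)

-- the r-th smallest entry (r ≥ 1) of an ascending list
ranked : List ℕ → ℕ → ℕ
ranked hs r = nth hs (r ∸ 1)

ranked-< : ∀ {hs} → Ascending hs → ∀ {x y} → InRange (length hs) x → InRange (length hs) y →
           x < y → ranked hs x < ranked hs y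
ranked-< asc {suc x} {suc y} (_ , x≤) (_ , y≤) (s≤s x<y) = ascending-nth asc x<y y≤

≤⇒≤ᵇ≡true : ∀ {m n} → m ≤ n → (m ≤ᵇ n) ≡ true
≤⇒≤ᵇ≡true {m} {n} m≤n with m ≤ᵇ n | ≤⇒≤ᵇ m≤n
... | true | _ = refl

>⇒≤ᵇ≡false : ∀ {m n} → n < m → (m ≤ᵇ n) ≡ false
>⇒≤ᵇ≡false {m} {n} n<m with m ≤ᵇ n in m≤ᵇn
... | true  = ⊥-elim (<⇒≱ n<m (≤ᵇ⇒≤ m n (subst True (sym m≤ᵇn) tt)))
... | false = refl

ranked-≤ᵇ : ∀ {hs} → Ascending hs → ∀ {x y} → InRange (length hs) x → InRange (length hs) y →
            (x ≤ᵇ y) ≡ (ranked hs x ≤ᵇ ranked hs y)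
ranked-≤ᵇ {hs} asc {x} {y} x∈ y∈ with <-cmp x y
... | tri< x<y _ _ = trans (≤⇒≤ᵇ≡true (<⇒≤ x<y)) (sym (≤⇒≤ᵇ≡true (<⇒≤ (ranked-< asc x∈ y∈ x<y))))
... | tri≈ _ refl _ = trans (≤⇒≤ᵇ≡true {x} ≤-refl) (sym (≤⇒≤ᵇ≡true {ranked hs x} ≤-refl))
... | tri> _ _ y<x = trans (>⇒≤ᵇ≡false y<x) (sym (>⇒≤ᵇ≡false (ranked-< asc y∈ x∈ y<x)))

isort-ranked : ∀ hs p → Ascending hs → All (InRange (length hs)) p →
               isort (map (ranked hs) p) ≡ map (ranked hs) (isort p)
isort-ranked hs p asc = isort-map (ranked hs) (InRange (length hs)) (ranked-≤ᵇ asc) p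

-- `vals π js` is 0, the sorted values of the occurrence, then n + 1
withSentinels : List ℕ → ℕ → List ℕ
withSentinels hs n = 0 ∷ hs ++ [ suc n ]

withSentinels-ascending : ∀ {hs n} → Ascending hs → All (InRange n) hs → Ascending (withSentinels hs n)
withSentinels-ascending {[]}     _   _               = s≤s z≤n ∷ [-]
withSentinels-ascending {h ∷ hs} asc bounds@((1≤h , _) ∷ _) =
  1≤h ∷ ascending-++-[] asc (All.map (λ (_ , y≤n) → s≤s y≤n) bounds)

Occ-intro : ∀ p π js hs → length js ≡ length p → Ascending (idxs π js) → Ascending hs →
            All (InRange (length hs)) p → map (at π) js ≡ map (ranked hs) p → Occ p π js
Occ-intro p π js hs len idxs↑ hs↑ ranks eq = record
  { len  = len
  ; incr = λ i j i<j j< → subst₂ _<_ (nth-++ˡ js _ i (<-trans i<j j<)) (nth-++ˡ js _ j j<)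
                           (ascending-nth idxs↑ (s≤s i<j) (s≤s (inner j<)))
  ; pos1 = λ i i< → subst (0 <_) (nth-++ˡ js _ i i<) (ascending-nth idxs↑ (s≤s z≤n) (s≤s (inner i<)))
  ; posn = λ i i< → ≤-pred (subst₂ _<_ (nth-++ˡ js _ i i<) (nth-++-length js (suc (length π)))
                           (ascending-nth idxs↑ (s≤s i<) (s≤s last)))
  ; iso  = λ i j i< j< → mk⇔ (reflect i j i< j<) (preserve i j i< j<)
  }
  where
  inner : ∀ {i} → i < length js → i < length (js ++ [ suc (length π) ])
  inner {i} i< rewrite length-++ js {[ suc (length π) ]} = ≤-trans i< (m≤m+n (length js) 1)
  last : length js < length (js ++ [ suc (length π) ])
  last rewrite length-++ js {[ suc (length π) ]} | +-comm (length js) 1 = ≤-refl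
  value : ∀ i → i < length js → at π (nth js i) ≡ ranked hs (nth p i)
  value i i< = trans (sym (nth-map (at π) js i i<))
                 (trans (cong (λ l → nth l i) eq) (nth-map (ranked hs) p i (subst (i <_) len i<)))
  rank∈ : ∀ i → i < length js → InRange (length hs) (nth p i)
  rank∈ i i< = All.lookup ranks (nth-∈ p i (subst (i <_) len i<))
  preserve : ∀ i j → i < length js → j < length js → nth p i < nth p j → at π (nth js i) < at π (nth js j)
  preserve i j i< j< lt = subst₂ _<_ (sym (value i i<)) (sym (value j j<)) (ranked-< hs↑ (rank∈ i i<) (rank∈ j j<) lt)
  reflect : ∀ i j → i < length js → j < length js → at π (nth js i) < at π (nth js j) → nth p i < nth p j
  reflect i j i< j< lt with <-cmp (nth p i) (nth p j)
  ... | tri< p< _ _ = p<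
  ... | tri≈ _ p≡ _ = ⊥-elim (<-irrefl (trans (value i i<) (trans (cong (ranked hs) p≡) (sym (value j j<)))) lt)
  ... | tri> _ _ p> = ⊥-elim (<-asym lt (preserve j i j< i< p>))

Occ⇒idxs-ascending : ∀ {p π js} → Occ p π js → Ascending (idxs π js)
Occ⇒idxs-ascending {p} {π} {js} o = ascending-from-nth (idxs π js) ordered
  where
  top = suc (length π)
  entry : ∀ i → i < length js → nth (js ++ [ top ]) i ≡ nth js i
  entry = nth-++ˡ js [ top ]
  end : ∀ {j} → j < length (js ++ [ top ]) → length js ≤ j → nth (js ++ [ top ]) j ≡ top
  end {j} j< js≤j rewrite length-++ js {[ top ]} | +-comm (length js) 1
    with ≤-antisym (≤-pred j<) js≤j
  ... | refl = nth-++-length js top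
  ordered : ∀ i j → i < j → j < length (idxs π js) → nth (idxs π js) i < nth (idxs π js) j
  ordered zero (suc j) _ (s≤s j<) with j <? length js
  ... | yes j<js = subst (0 <_) (sym (entry j j<js)) (Occ.pos1 o j j<js)
  ... | no j≮js  = subst (0 <_) (sym (end j< (≮⇒≥ j≮js))) (s≤s z≤n)
  ordered (suc i) (suc j) (s≤s i<j) (s≤s j<) with j <? length js
  ... | yes j<js = subst₂ _<_ (sym (entry i (<-trans i<j j<js))) (sym (entry j j<js)) (Occ.incr o i j i<j j<js)
  ... | no j≮js  = subst₂ _<_ (sym (entry i i<js)) (sym (end j< (≮⇒≥ j≮js))) (s≤s (Occ.posn o i i<js))
    where
    i<js : i < length js
    i<js = <-≤-trans i<j (≤-pred (subst (j <_) (trans (length-++ js) (+-comm (length js) 1)) j<))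

module _ {p π js : List ℕ} (o : Occ p π js) where

  Occ-position-< : ∀ i j → {Holds (i <? j)} → {Holds (j <? length js)} → nth js i < nth js j
  Occ-position-< i j {i<j} {j<} = Occ.incr o i j (toWitness i<j) (toWitness j<)

  Occ-position-range : ∀ i → {Holds (i <? length js)} → InRange (length π) (nth js i)
  Occ-position-range i {i<} = Occ.pos1 o i (toWitness i<) , Occ.posn o i (toWitness i<)

  Occ-value-< : ∀ i j → {Holds (i <? length js)} → {Holds (j <? length js)} → {Holds (nth p i <? nth p j)} →
                at π (nth js i) < at π (nth js j)
  Occ-value-< i j {i<} {j<} {lt} = Equivalence.from (Occ.iso o i j (toWitness i<) (toWitness j<)) (toWitness lt)

-- the (0-based) positions of the entries 1, …, k of a pattern p ∈ S_k
rankPositions : List ℕ → List ℕ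
rankPositions p = map (λ r → positionOf r p) (map suc (upTo (length p)))
  where
  positionOf : ℕ → List ℕ → ℕ
  positionOf r []       = 0
  positionOf r (x ∷ xs) = if r ≡ᵇ x then 0 else suc (positionOf r xs)

RankOrdered : List ℕ → List ℕ → Set
RankOrdered p ks = All (_< length p) ks × Linked (λ k k′ → nth p k < nth p k′) ks

rankOrdered? : ∀ p ks → Dec (RankOrdered p ks)
rankOrdered? p ks = all? (_<? length p) ks ×-dec linked? (λ k k′ → nth p k <? nth p k′) ks

Below : (ℕ → ℕ) → ℕ → ℕ → ℕ → Set
Below g l h v = ∀ r → l < r → r < h → g r < v

DecreasingAbove : (ℕ → ℕ) → ℕ → ℕ → ℕ → Set
DecreasingAbove g l h v = ∀ r r′ → l < r → r < r′ → r′ < h → v < g r → v < g r′ → g r′ < g r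

rows : ℕ → ℕ → List ℕ
rows lo hi = map (lo +_) (upTo (hi ∸ lo))

∈-rows : ∀ {lo hi b} → lo ≤ b → b < hi → b ∈ rows lo hi
∈-rows {lo} {hi} {b} lo≤b b<hi =
  subst (_∈ rows lo hi) (m+[n∸m]≡n lo≤b) (∈-map⁺ (lo +_) (∈-upTo⁺ (∸-monoˡ-< b<hi lo≤b)))

RowsIn : ℕ → ℕ → ℕ → List Box → Set
RowsIn a lo hi R = lo < hi × All (λ b → (a , b) ∈ R) (rows lo hi)

rowsIn? : ∀ a lo hi R → Dec (RowsIn a lo hi R)
rowsIn? a lo hi R = (lo <? hi) ×-dec all? (λ b → (a , b) ∈? R) (rows lo hi)

CoveredBy : List Box → List Box → Set
CoveredBy bounds R = All (λ ab → Any (λ bd → proj₁ bd ≡ proj₁ ab × proj₂ bd ≤ proj₂ ab) bounds) R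

coveredBy? : ∀ bounds R → Dec (CoveredBy bounds R)
coveredBy? bounds = all? (λ ab → any? (λ bd → (proj₁ bd ≟ proj₁ ab) ×-dec (proj₂ bd ≤? proj₂ ab)) bounds)

ColumnFrom : ℕ → ℕ → List Box → Set
ColumnFrom a lo D = All (λ ab → proj₁ ab ≡ a × lo ≤ proj₂ ab) D

columnFrom? : ∀ a lo D → Dec (ColumnFrom a lo D)
columnFrom? a lo = all? (λ ab → (proj₁ ab ≟ a) ×-dec (lo ≤? proj₂ ab))

module Search {P : ℕ → Set} (P? : ∀ r → Dec (P r)) where

  First : ℕ → ℕ → Set
  First lo hi = ∃ λ x → lo < x × x < hi × P x × (∀ r → lo < r → r < x → ¬ P r)

  Last : ℕ → ℕ → Set
  Last lo hi = ∃ λ z → lo < z × z < hi × P z × (∀ r → z < r → r < hi → ¬ P r)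

  None : ℕ → ℕ → Set
  None lo hi = ∀ r → lo < r → r < hi → ¬ P r

  private
    extend : ∀ {lo h} → None lo h → ¬ P h → None lo (suc h)
    extend none ¬ph r lo<r r<1+h with m≤n⇒m<n∨m≡n (≤-pred r<1+h)
    ... | inj₁ r<h  = none r lo<r r<h
    ... | inj₂ refl = ¬ph

  earliest : ∀ lo hi → None lo hi ⊎ First lo hi
  earliest lo zero = inj₁ (λ _ _ ())
  earliest lo (suc h) with earliest lo h
  ... | inj₂ (x , lo<x , x<h , px , min) = inj₂ (x , lo<x , m<n⇒m<1+n x<h , px , min)
  ... | inj₁ none with lo <? h
  ...   | no lo≮h = inj₁ (λ r lo<r r<1+h _ → lo≮h (<-≤-trans lo<r (≤-pred r<1+h)))
  ...   | yes lo<h with P? h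
  ...     | yes ph  = inj₂ (h , lo<h , ≤-refl , ph , none)
  ...     | no ¬ph  = inj₁ (extend none ¬ph)

  latest : ∀ lo hi → None lo hi ⊎ Last lo hi
  latest lo zero = inj₁ (λ _ _ ())
  latest lo (suc h) with lo <? h
  ... | no lo≮h = inj₁ (λ r lo<r r<1+h _ → lo≮h (<-≤-trans lo<r (≤-pred r<1+h)))
  ... | yes lo<h with P? h
  ...   | yes ph = inj₂ (h , lo<h , ≤-refl , ph , λ r h<r r<1+h _ → <⇒≱ h<r (≤-pred r<1+h))
  ...   | no ¬ph with latest lo h
  ...     | inj₁ none = inj₁ (extend none ¬ph)
  ...     | inj₂ (z , lo<z , z<h , pz , max) = inj₂ (z , lo<z , m<n⇒m<1+n z<h , pz , extend max ¬ph)

nonCircledFrom-All : ∀ {P : ℕ → Set} k c {xs} → All P xs → All P (nonCircledFrom k c xs)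
nonCircledFrom-All k c []                 = []
nonCircledFrom-All k c {x ∷ xs} (px ∷ pxs) with any (k ≡ᵇ_) c
... | true  = nonCircledFrom-All (suc k) c pxs
... | false = px ∷ nonCircledFrom-All (suc k) c pxs

module Permutation (π : List ℕ) (Uπ : Unique π) (range : ∀ {y} → y ∈ π → InRange (length π) y) where

  n : ℕ
  n = length π

  f : ℕ → ℕ
  f = at π

  f-range : ∀ {t} → InRange n t → InRange n (f t)
  f-range {suc t} (_ , t≤) = range (nth-∈ π t t≤)

  f-injective : ∀ {s t} → InRange n s → InRange n t → f s ≡ f t → s ≡ t
  f-injective {suc s} {suc t} (_ , s≤) (_ , t≤) eq = cong suc (nth-injective Uπ s t s≤ t≤ eq)

  f-injective-map : ∀ {xs ys} → All (InRange n) xs → All (InRange n) ys → map f xs ≡ map f ys → xs ≡ ys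
  f-injective-map []          []          _  = refl
  f-injective-map (x∈ ∷ xs∈) (y∈ ∷ ys∈) eq with ∷-injective eq
  ... | x≡ , xs≡ = cong₂ _∷_ (f-injective x∈ y∈ x≡) (f-injective-map xs∈ ys∈ xs≡)

  Occ⇒positions : ∀ {p js} → Occ p π js → All (InRange n) js
  Occ⇒positions {js = js} o = nth⇒All js (λ i i< → Occ.pos1 o i i< , Occ.posn o i i<)

  range-≤ : ∀ {r t} → 1 ≤ r → r ≤ t → InRange n t → InRange n r
  range-≤ 1≤r r≤t (_ , t≤n) = 1≤r , ≤-trans r≤t t≤n

  f-∈ : ∀ {t} → InRange n t → f t ∈ π
  f-∈ {suc t} (_ , t≤) = nth-∈ π t t≤

  ∈⇒f : ∀ {y} → y ∈ π → ∃ λ t → InRange n t × f t ≡ y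
  ∈⇒f y∈ with ∈⇒nth y∈
  ... | i , i< , eq = suc i , (s≤s z≤n , i<) , eq

  f-<-or-> : ∀ {r s} → InRange n r → InRange n s → r ≢ s → f r < f s ⊎ f s < f r
  f-<-or-> {r} {s} r∈ s∈ r≢s with <-cmp (f r) (f s)
  ... | tri< lt _ _ = inj₁ lt
  ... | tri≈ _ eq _ = ⊥-elim (r≢s (f-injective r∈ s∈ eq))
  ... | tri> _ _ gt = inj₂ gt

  f-≮⇒< : ∀ {r s} → InRange n r → InRange n s → r ≢ s → ¬ (f s < f r) → f r < f s
  f-≮⇒< r∈ s∈ r≢s ≮ with f-<-or-> r∈ s∈ r≢s
  ... | inj₁ lt = lt
  ... | inj₂ gt = ⊥-elim (≮ gt)

  f-before : ∀ {p q} → InRange n p → p < q → InRange n q → Before π (f p) (f q)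
  f-before {suc p} {suc q} _ (s≤s p<q) (_ , q≤) = nth-before π p q p<q q≤

  f-between : ∀ {p r q} → InRange n p → p < r → r < q → InRange n q → Between π (f p) (f q) (f r)
  f-between {suc p} {suc r} {suc q} _ (s≤s p<r) (s≤s r<q) (_ , q≤) = nth-between π p r q p<r r<q q≤

  before⇒f : ∀ {u v} → Before π u v → ∃₂ λ p q → InRange n p × p < q × InRange n q × f p ≡ u × f q ≡ v
  before⇒f b with before⇒nth b
  ... | i , j , i<j , j< , eu , ev = suc i , suc j , (s≤s z≤n , <-trans i<j j<) , s≤s i<j , (s≤s z≤n , j<) , eu , ev

  before⇒< : ∀ {s t} → InRange n s → InRange n t → Before π (f s) (f t) → s < t
  before⇒< s∈ t∈ b with before⇒f b
  ... | p , q , p∈ , p<q , q∈ , fp≡ , fq≡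
    with f-injective p∈ s∈ fp≡ | f-injective q∈ t∈ fq≡
  ... | refl | refl = p<q

  between⇒f : ∀ {p q w} → InRange n p → InRange n q → Between π (f p) (f q) w →
              ∃ λ r → p < r × r < q × f r ≡ w
  between⇒f p∈ q∈ bw with between⇒nth bw
  ... | i , k , j , i<k , k<j , j< , ep , eq , ew
    with f-injective {suc i} (s≤s z≤n , <-trans i<k (<-trans k<j j<)) p∈ ep
       | f-injective {suc j} (s≤s z≤n , j<) q∈ eq
  ... | refl | refl = suc k , s≤s i<k , s≤s k<j , ew

  between-below : ∀ {p q v} → InRange n p → InRange n q → Below f p q v → ∀ w → Between π (f p) (f q) w → w < v
  between-below p∈ q∈ below w bw with between⇒f p∈ q∈ bw
  ... | r , p<r , r<q , refl = below r p<r r<q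

  InColumn : List ℕ → ℕ → ℕ → Set
  InColumn js a t = nth (idxs π js) a < t × t < nth (idxs π js) (suc a)

  module _ {js : List ℕ} (idxs↑ : Ascending (idxs π js)) where

    private
      I = idxs π js

      length-idxs : length I ≡ suc (suc (length js))
      length-idxs = cong suc (trans (length-++ js) (+-comm (length js) 1))

      idxs-last : nth I (suc (length js)) ≡ suc n
      idxs-last = nth-++-length js (suc n)

      idxs-js : ∀ {m} → m < length js → nth I (suc m) ≡ nth js m
      idxs-js {m} = nth-++ˡ js _ m

      inner : ∀ {m} → m < length js → suc m < length I
      inner {m} m< = subst (suc m <_) (sym length-idxs) (s≤s (m<n⇒m<1+n m<))

      top : suc (length js) < length I
      top = subst (suc (length js) <_) (sym length-idxs) ≤-refl

    positions : All (InRange n) js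
    positions = nth⇒All js (λ i i< →
      subst (1 ≤_) (idxs-js i<) (ascending-nth idxs↑ (s≤s z≤n) (inner i<)) ,
      ≤-pred (subst₂ _<_ (idxs-js i<) idxs-last (ascending-nth idxs↑ (s≤s i<) top)))

    column-range : ∀ {a t} → InColumn js a t → InRange n t
    column-range {a} {t} (a<t , t<a+1) =
      ≤-<-trans z≤n a<t ,
      ≤-pred (<-≤-trans t<a+1 (subst (nth I (suc a) ≤_) idxs-last
        (ascending-nth-≤ idxs↑ (≤-pred (subst (suc a <_) length-idxs (nth-defined I t<a+1))) top)))

    column-∉ : ∀ {a t} → InColumn js a t → t ∈ js → ⊥
    column-∉ {a} {t} (a<t , t<a+1) t∈ with ∈⇒nth t∈
    ... | m , m< , refl with <-cmp (suc m) a
    ...   | tri< m+1<a _ _ = <⇒≱ a<t (subst (_≤ nth I a) (idxs-js m<)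
                              (ascending-nth-≤ idxs↑ (<⇒≤ m+1<a) (<-trans (n<1+n a) (nth-defined I t<a+1))))
    ...   | tri≈ _ refl _ = <-irrefl (idxs-js m<) a<t
    ...   | tri> _ _ a<m+1 = <⇒≱ t<a+1 (subst (nth I (suc a) ≤_) (idxs-js m<)
                              (ascending-nth-≤ idxs↑ a<m+1 (inner m<)))

    column-∉-vals : ∀ {a t} → InColumn js a t → ∀ {y} → y ∈ vals π js → f t ≢ y
    column-∉-vals col (here refl) ft≡0 = <⇒≢ (proj₁ (f-range (column-range col))) (sym ft≡0)
    column-∉-vals col (there y∈) ft≡y with ∈-++⁻ (isort (map f js)) y∈
    ... | inj₂ (here refl) = <⇒≢ (s≤s (proj₂ (f-range (column-range col)))) ft≡y
    ... | inj₁ y∈sorted with ∈-map⁻ f (isort-∈⁻ (map f js) y∈sorted)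
    ...   | j , j∈ , refl =
      column-∉ col (subst (_∈ js) (sym (f-injective (column-range col) (All.lookup positions j∈) ft≡y)) j∈)

  -- V is vals π js in a form whose entries compute (isort is stuck on unknown values)
  record Frame (js V : List ℕ) : Set where
    constructor frame
    field
      vals≡ : vals π js ≡ V
      idxs↑ : Ascending (idxs π js)
      vals↑ : Ascending V

  vals-top : ∀ js → nth (vals π js) (suc (length js)) ≡ suc n
  vals-top js = subst (λ k → nth (isort (map f js) ++ [ suc n ]) k ≡ suc n)
                      (trans (length-isort (map f js)) (length-map f js))
                      (nth-++-length (isort (map f js)) (suc n))

  module _ {js V : List ℕ} (F : Frame js V) where

    private
      I = idxs π js
      open Frame F

    ColumnBelow : Box → Set
    ColumnBelow (a , lo) = Below f (nth I a) (nth I (suc a)) (nth V lo)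

    box-value : ∀ {a b t} → InBox π js (a , b) t → nth V b < f t × f t < nth V (suc b)
    box-value {b = b} {t} (_ , _ , b<ft , ft<b+1) =
      subst (λ W → nth W b < f t) vals≡ b<ft , subst (λ W → f t < nth W (suc b)) vals≡ ft<b+1

    private
      box-above : ∀ {a b lo t} → lo ≤ b → InBox π js (a , b) t → nth V lo < f t
      box-above {b = b} lo≤b box =
        ≤-<-trans (ascending-nth-≤ vals↑ lo≤b (<-trans (n<1+n b) (nth-defined V (proj₂ (box-value box)))))
                  (proj₁ (box-value box))

      column-above : ∀ {a lo D t} → ColumnFrom a lo D → InUnion π js D t → InColumn js a t × nth V lo < f t
      column-above ((refl , lo≤b) ∷ _) (here box@(a<t , t<a+1 , _)) = (a<t , t<a+1) , box-above lo≤b box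
      column-above (_ ∷ cols) (there inD) = column-above cols inD

      column-≢ : ∀ {a t} → InColumn js a t → ∀ m → m < length V → f t ≢ nth V m
      column-≢ col m m< = column-∉-vals idxs↑ col (subst (nth V m ∈_) (sym vals≡) (nth-∈ V m m<))

      inBox-rows : ∀ {a lo hi R t} → RowsIn a lo hi R → InColumn js a t →
                   nth V lo < f t → f t < nth V hi → InUnion π js R t
      inBox-rows {a} {lo} {hi} {R} {t} (lo<hi , rowsIn) col@(a<t , t<a+1) lo<ft ft<hi
        with locate vals↑ lo hi lo<hi (nth-defined V ft<hi) lo<ft ft<hi (column-≢ col)
      ... | b , lo≤b , b<hi , b<ft , ft<b+1 =
        Any.map (λ { refl → a<t , t<a+1 , subst (λ W → nth W b < f t) (sym vals≡) b<ft ,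
                                           subst (λ W → f t < nth W (suc b)) (sym vals≡) ft<b+1 })
                (All.lookup rowsIn (∈-rows lo≤b b<hi))

    rows-empty : ∀ {R} → Empty π js R → ∀ a lo hi → {Holds (rowsIn? a lo hi R)} →
                 ∀ {t} → InColumn js a t → nth V lo < f t → f t < nth V hi → ⊥
    rows-empty {R} E a lo hi {ok} {t} col lo<ft ft<hi =
      E t (inBox-rows (toWitness {a? = rowsIn? a lo hi R} ok) col lo<ft ft<hi)

    column-below : ∀ {R} → Empty π js R → ∀ a lo → {Holds (rowsIn? a lo (suc (length js)) R)} → ColumnBelow (a , lo)
    column-below E a lo {ok} t a<t t<a+1 with <-cmp (f t) (nth V lo)
    ... | tri< ft<lo _ _ = ft<lo
    ... | tri≈ _ ft≡lo _ = ⊥-elim (column-≢ col lo (nth-defined V (subst (0 <_) ft≡lo (proj₁ (f-range t∈)))) ft≡lo)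
      where
      col = (a<t , t<a+1)
      t∈ = column-range idxs↑ col
    ... | tri> _ _ lo<ft = ⊥-elim (rows-empty E a lo (suc (length js)) {ok} col lo<ft ft<top)
      where
      col = (a<t , t<a+1)
      ft<top : f t < nth V (suc (length js))
      ft<top = subst (f t <_) (trans (sym (vals-top js)) (cong (λ W → nth W (suc (length js))) vals≡))
                     (s≤s (proj₂ (f-range (column-range idxs↑ col))))

    column-decreasing : ∀ {D} → Decreasing π js D → ∀ a lo hi → {Holds (rowsIn? a lo hi D)} →
                        ColumnBelow (a , hi) → DecreasingAbove f (nth I a) (nth I (suc a)) (nth V lo)
    column-decreasing {D} dec a lo hi {ok} below r r′ a<r r<r′ r′<a+1 lo<r lo<r′ =
      dec r r′ r<r′ (inBox-rows rowsIn (a<r , r<a+1) lo<r (below r a<r r<a+1))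
                    (inBox-rows rowsIn (a<r′ , r′<a+1) lo<r′ (below r′ a<r′ r′<a+1))
      where
      rowsIn = toWitness {a? = rowsIn? a lo hi D} ok
      r<a+1 = <-trans r<r′ r′<a+1
      a<r′ = <-trans a<r r<r′

    Empty-intro : ∀ bounds → All ColumnBelow bounds → ∀ {R} → {Holds (coveredBy? bounds R)} → Empty π js R
    Empty-intro bounds belows {R} {ok} t = outside R (toWitness {a? = coveredBy? bounds R} ok)
      where
      under-bound : ∀ {a b bs} → All ColumnBelow bs → Any (λ bd → proj₁ bd ≡ a × proj₂ bd ≤ b) bs →
                    InBox π js (a , b) t → ⊥
      under-bound (below ∷ _) (here (refl , lo≤b)) box@(a<t , t<a+1 , _) = <-asym (below t a<t t<a+1) (box-above lo≤b box)
      under-bound (_ ∷ belows) (there covered) box = under-bound belows covered box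
      outside : ∀ R → CoveredBy bounds R → ¬ InUnion π js R t
      outside ((a , b) ∷ _) (covered ∷ _) (here box) = under-bound belows covered box
      outside (_ ∷ R)       (_ ∷ covers)  (there inR) = outside R covers inR

    Decreasing-intro : ∀ a lo → DecreasingAbove f (nth I a) (nth I (suc a)) (nth V lo) →
                       ∀ {D} → {Holds (columnFrom? a lo D)} → Decreasing π js D
    Decreasing-intro a lo decreasing {D} {ok} t t′ t<t′ inD inD′
      with column-above (toWitness {a? = columnFrom? a lo D} ok) inD
         | column-above (toWitness {a? = columnFrom? a lo D} ok) inD′
    ... | (a<t , _) , lo<t | (_ , t′<a+1) , lo<t′ = decreasing t t′ a<t t<t′ t′<a+1 lo<t lo<t′

  sortedValues : List ℕ → List ℕ → List ℕ
  sortedValues p js = map (λ k → f (nth js k)) (rankPositions p)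

  -- both equations hold by computation once p and the shape of js are fixed
  Frame-intro : ∀ p js → let hs = sortedValues p js in
                Ascending (idxs π js) → Ascending (withSentinels hs n) →
                {Holds (all? (inRange? (length hs)) p)} →
                map f js ≡ map (ranked hs) p → map (ranked hs) (isort p) ≡ hs → Frame js (withSentinels hs n)
  Frame-intro p js idxs↑ V↑ {ok} values sorted = frame vals≡ idxs↑ V↑
    where
    hs = sortedValues p js
    vals≡ : vals π js ≡ withSentinels hs n
    vals≡ = cong (λ l → 0 ∷ l ++ [ suc n ])
      (trans (cong isort values)
        (trans (isort-ranked hs p (ascending-++⁻ˡ hs (ascending-tail V↑)) (toWitness ok)) sorted))

  Frame⇒Occ : ∀ p {js} → let hs = sortedValues p js in
              Frame js (withSentinels hs n) → length js ≡ length p →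
              {Holds (all? (inRange? (length hs)) p)} → map f js ≡ map (ranked hs) p → Occ p π js
  Frame⇒Occ p {js} F len {ok} values =
    Occ-intro p π js hs len (Frame.idxs↑ F) (ascending-++⁻ˡ hs (ascending-tail (Frame.vals↑ F))) (toWitness ok) values
    where hs = sortedValues p js

  Occ⇒Frame : ∀ {p js} → Occ p π js → {Holds (rankOrdered? p (rankPositions p))} →
              {Holds (all? (inRange? (length (sortedValues p js))) p)} →
              map f js ≡ map (ranked (sortedValues p js)) p →
              map (ranked (sortedValues p js)) (isort p) ≡ sortedValues p js →
              Frame js (withSentinels (sortedValues p js) n)
  Occ⇒Frame {p} {js} o {ordered} {ok} values sorted =
    Frame-intro p js idxs↑ (withSentinels-ascending (ascending ks (proj₁ ks-ordered) (proj₂ ks-ordered)) in-range)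
                {ok} values sorted
    where
    idxs↑ = Occ⇒idxs-ascending o
    ks = rankPositions p
    ks-ordered = toWitness ordered
    ascending : ∀ ks → All (_< length p) ks → Linked (λ k k′ → nth p k < nth p k′) ks →
                Ascending (map (λ k → f (nth js k)) ks)
    ascending []            _                  _          = []
    ascending (k ∷ [])      _                  _          = [-]
    ascending (k ∷ k′ ∷ ks) (k< ∷ k′< ∷ ks<) (lt ∷ lnk) =
      Equivalence.from (Occ.iso o k k′ (js< k<) (js< k′<)) lt ∷ ascending (k′ ∷ ks) (k′< ∷ ks<) lnk
      where js< = λ {i} (i< : i < length p) → subst (i <_) (sym (Occ.len o)) i<
    in-range : All (InRange n) (map (λ k → f (nth js k)) ks)
    in-range = All.map⁺ (All.map (λ k< → f-range (All.lookup (Occ⇒positions o) (nth-∈ js _ (subst (_ <_) (sym (Occ.len o)) k<))))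
                                 (proj₁ ks-ordered))

  nonCircled-injective : ∀ {J js ys} → Occ (under J) π js → All (InRange n) ys →
                         map f (nonCircled J js) ≡ map f ys → nonCircled J js ≡ ys
  nonCircled-injective {J} o ys∈ =
    f-injective-map (nonCircledFrom-All 1 (circled J) (Occ⇒positions o)) ys∈

↭-by-rank-3241 : ∀ {p q r s : ℕ} → p ∷ q ∷ r ∷ s ∷ [] ↭ s ∷ q ∷ p ∷ r ∷ []
↭-by-rank-3241 {p} {q} {r} {s} =
  ↭-trans (prep p (prep q (swap r s ↭-refl)))
    (↭-trans (prep p (swap q s ↭-refl)) (↭-trans (swap p s ↭-refl) (prep s (swap p q ↭-refl))))

module J1Occurrence (π : List ℕ) (Uπ : Unique π) (range : ∀ {y} → y ∈ π → InRange (length π) y)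
                    (i1 i2 i3 i4 i5 : ℕ) (o : Occ j1 π (i1 ∷ i2 ∷ i3 ∷ i4 ∷ i5 ∷ [])) where

  open Permutation π Uπ range

  IS : List ℕ
  IS = i1 ∷ i2 ∷ i3 ∷ i4 ∷ i5 ∷ []

  a b c d e : ℕ
  a = f i1
  b = f i2
  c = f i3
  d = f i4
  e = f i5

  i1<i2 : i1 < i2
  i1<i2 = Occ-position-< o 0 1
  i2<i3 : i2 < i3
  i2<i3 = Occ-position-< o 1 2
  i3<i4 : i3 < i4
  i3<i4 = Occ-position-< o 2 3
  i4<i5 : i4 < i5
  i4<i5 = Occ-position-< o 3 4

  i1∈ : InRange n i1
  i1∈ = Occ-position-range o 0
  i2∈ : InRange n i2
  i2∈ = Occ-position-range o 1
  i3∈ : InRange n i3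
  i3∈ = Occ-position-range o 2
  i4∈ : InRange n i4
  i4∈ = Occ-position-range o 3
  i5∈ : InRange n i5
  i5∈ = Occ-position-range o 4

  e<b : e < b
  e<b = Occ-value-< o 4 1
  b<a : b < a
  b<a = Occ-value-< o 1 0
  a<c : a < c
  a<c = Occ-value-< o 0 2
  c<d : c < d
  c<d = Occ-value-< o 2 3

  left∈ : ∀ {t} → 1 ≤ t → t < i1 → InRange n t
  left∈ 1≤t t<i1 = range-≤ 1≤t (<⇒≤ t<i1) i1∈

  middle∈ : ∀ {t} → i1 < t → t < i2 → InRange n t
  middle∈ i1<t t<i2 = range-≤ (≤-trans (proj₁ i1∈) (<⇒≤ i1<t)) (<⇒≤ t<i2) i2∈

  -- Entries above c that S(π) places between a and b

  SeparatorInside : Set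
  SeparatorInside = ∃₂ λ p q → i1 < p × p < q × q < i2 × c < f p × f p < f q

  SeparatorLeft : Set
  SeparatorLeft = ∃₂ λ p q → 1 ≤ p × p < i1 × i1 < q × q < i2 × c < f p × f p < f q × Below f p i1 (f p)

  NoSeparator : Set
  NoSeparator = ¬ SeparatorLeft × ¬ SeparatorInside

  LeftGuard : ℕ → Set
  LeftGuard w = (∀ r → 1 ≤ r → r < i1 → c < f r → f r < f w → ⊥) ⊎
                (∃ λ z → 1 ≤ z × z < i1 × f w < f z × Below f z i1 c)

  record Peak : Set where
    field
      w          : ℕ
      i1<w       : i1 < w
      w<i2       : w < i2
      c<w        : c < f w
      before     : Below f i1 w c
      after      : Below f w i2 (f w)
      decreasing : DecreasingAbove f w i2 c
      guard      : LeftGuard w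

  below⇒noSeparator : Below f i1 i2 c → NoSeparator
  below⇒noSeparator below =
    (λ (_ , q , _ , _ , i1<q , q<i2 , c<p , p<q , _) → <-asym (<-trans c<p p<q) (below q i1<q q<i2)) ,
    (λ (_ , q , i1<p , p<q , q<i2 , c<p , p<q′) → <-asym (<-trans c<p p<q′) (below q (<-trans i1<p p<q) q<i2))

  peak⇒noSeparator : Peak → NoSeparator
  peak⇒noSeparator peak = noLeft guard , noInside
    where
    open Peak peak
    ≤peak : ∀ {q y} → i1 < q → q < i2 → c < y → y < f q → y < f w
    ≤peak {q} i1<q q<i2 c<y y<q with <-cmp q w
    ... | tri< q<w _ _ = ⊥-elim (<-asym (<-trans c<y y<q) (before q i1<q q<w))
    ... | tri≈ _ refl _ = y<q
    ... | tri> _ _ w<q = <-trans y<q (after q w<q q<i2)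
    noInside : ¬ SeparatorInside
    noInside (p , q , i1<p , p<q , q<i2 , c<p , p<q′) with <-cmp p w
    ... | tri< p<w _ _ = <-asym c<p (before p i1<p p<w)
    ... | tri≈ _ refl _ = <-asym p<q′ (after q p<q q<i2)
    ... | tri> _ _ w<p = <-asym p<q′ (decreasing p q w<p p<q q<i2 c<p (<-trans c<p p<q′))
    noLeft : LeftGuard w → ¬ SeparatorLeft
    noLeft (inj₁ none) (p , q , 1≤p , p<i1 , i1<q , q<i2 , c<p , p<q′ , _) =
      none p 1≤p p<i1 c<p (≤peak i1<q q<i2 c<p p<q′)
    noLeft (inj₂ (z , _ , z<i1 , w<z , z-below)) (p , q , _ , p<i1 , i1<q , q<i2 , c<p , p<q′ , p-above) with <-cmp p z
    ... | tri< p<z _ _ = <-asym (p-above z p<z z<i1) (<-trans (≤peak i1<q q<i2 c<p p<q′) w<z)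
    ... | tri≈ _ refl _ = <-asym w<z (≤peak i1<q q<i2 c<p p<q′)
    ... | tri> _ _ z<p = <-asym c<p (z-below p z<p p<i1)

  peak-after : ∀ x w → i1 < x → x < w → w < i2 → f x < c → c < f w →
               Below f i1 x a → Below f x w c → Below f w i2 (f w) → DecreasingAbove f w i2 c →
               LeftGuard w → Peak
  peak-after x w i1<x x<w w<i2 x<c c<w left middle after decreasing guard = record
    { w = w ; i1<w = <-trans i1<x x<w ; w<i2 = w<i2 ; c<w = c<w ; before = before
    ; after = after ; decreasing = decreasing ; guard = guard }
    where
    before : Below f i1 w c
    before r i1<r r<w with <-cmp r x
    ... | tri< r<x _ _ = <-trans (left r i1<r r<x) a<c
    ... | tri≈ _ refl _ = x<c
    ... | tri> _ _ x<r = middle r x<r r<w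

  peak-at : ∀ w → i1 < w → w < i2 → c < f w → Below f i1 w a → Below f w i2 (f w) →
            DecreasingAbove f w i2 c → LeftGuard w → Peak
  peak-at w i1<w w<i2 c<w left after decreasing guard = record
    { w = w ; i1<w = i1<w ; w<i2 = w<i2 ; c<w = c<w
    ; before = λ r i1<r r<w → <-trans (left r i1<r r<w) a<c
    ; after = after ; decreasing = decreasing ; guard = guard }

  -- Reading the column conditions off an occurrence of some J₁,ₖ

  -- Numeric arguments are box coordinates (column, row) as in the paper; the side
  -- conditions on them are decided by computation.

  j11⇒below : ∀ js → DecOcc J11 π js → length js ≡ 6 → nonCircled J11 js ≡ IS → Below f i1 i2 c
  j11⇒below (_ ∷ x ∷ _ ∷ _ ∷ _ ∷ _ ∷ []) (o′ , E , _) refl refl = below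
    where
    F = Occ⇒Frame o′ refl refl
    below : Below f i1 i2 c
    below r i1<r r<i2 with <-cmp r x
    ... | tri< r<x _ _ = <-trans (column-below F E 1 3 r i1<r r<x) a<c
    ... | tri≈ _ refl _ = Occ-value-< o′ 1 3
    ... | tri> _ _ x<r = column-below F E 2 5 r x<r r<i2

  j12⇒peak : ∀ js → DecOcc J12 π js → length js ≡ 7 → nonCircled J12 js ≡ IS → Peak
  j12⇒peak (_ ∷ x ∷ w ∷ _ ∷ _ ∷ _ ∷ _ ∷ []) (o′ , E , D) refl refl =
    peak-after x w (Occ-position-< o′ 0 1) (Occ-position-< o′ 1 2) (Occ-position-< o′ 2 3)
      (Occ-value-< o′ 1 4) (Occ-value-< o′ 4 2)
      (column-below F E 1 3) (column-below F E 2 5) (column-below F E 3 6)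
      (column-decreasing F D 3 5 6 (column-below F E 3 6))
      (inj₁ (λ r 1≤r r<i1 → rows-empty F E 0 5 6 (1≤r , r<i1)))
    where F = Occ⇒Frame o′ refl refl

  j13⇒peak : ∀ js → DecOcc J13 π js → length js ≡ 8 → nonCircled J13 js ≡ IS → Peak
  j13⇒peak (z ∷ _ ∷ x ∷ w ∷ _ ∷ _ ∷ _ ∷ _ ∷ []) (o′ , E , D) refl refl =
    peak-after x w (Occ-position-< o′ 1 2) (Occ-position-< o′ 2 3) (Occ-position-< o′ 3 4)
      (Occ-value-< o′ 2 5) (Occ-value-< o′ 5 3)
      (column-below F E 2 3) (column-below F E 3 5) (column-below F E 4 6)
      (column-decreasing F D 4 5 6 (column-below F E 4 6))
      (inj₂ (z , proj₁ (Occ-position-range o′ 0) , Occ-position-< o′ 0 1 , Occ-value-< o′ 3 0 , column-below F E 1 5))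
    where F = Occ⇒Frame o′ refl refl

  j14⇒peak : ∀ js → DecOcc J14 π js → length js ≡ 8 → nonCircled J14 js ≡ IS → Peak
  j14⇒peak (z ∷ _ ∷ x ∷ w ∷ _ ∷ _ ∷ _ ∷ _ ∷ []) (o′ , E , D) refl refl =
    peak-after x w (Occ-position-< o′ 1 2) (Occ-position-< o′ 2 3) (Occ-position-< o′ 3 4)
      (Occ-value-< o′ 2 5) (Occ-value-< o′ 5 3)
      (column-below F E 2 3) (column-below F E 3 5) (column-below F E 4 6)
      (column-decreasing F D 4 5 6 (column-below F E 4 6))
      (inj₂ (z , proj₁ (Occ-position-range o′ 0) , Occ-position-< o′ 0 1 , Occ-value-< o′ 3 0 , column-below F E 1 5))
    where F = Occ⇒Frame o′ refl refl

  j15⇒peak : ∀ js → DecOcc J15 π js → length js ≡ 7 → nonCircled J15 js ≡ IS → Peak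
  j15⇒peak (_ ∷ x ∷ w ∷ _ ∷ _ ∷ _ ∷ _ ∷ []) (o′ , E , D) refl refl =
    peak-after x w (Occ-position-< o′ 0 1) (Occ-position-< o′ 1 2) (Occ-position-< o′ 2 3)
      (Occ-value-< o′ 1 4) (Occ-value-< o′ 4 2)
      (column-below F E 1 3) (column-below F E 2 5) (column-below F E 3 7)
      (column-decreasing F D 3 5 7 (column-below F E 3 7))
      (inj₁ (λ r 1≤r r<i1 → rows-empty F E 0 5 7 (1≤r , r<i1)))
    where F = Occ⇒Frame o′ refl refl

  j16⇒peak : ∀ js → DecOcc J16 π js → length js ≡ 8 → nonCircled J16 js ≡ IS → Peak
  j16⇒peak (z ∷ _ ∷ x ∷ w ∷ _ ∷ _ ∷ _ ∷ _ ∷ []) (o′ , E , D) refl refl =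
    peak-after x w (Occ-position-< o′ 1 2) (Occ-position-< o′ 2 3) (Occ-position-< o′ 3 4)
      (Occ-value-< o′ 2 5) (Occ-value-< o′ 5 3)
      (column-below F E 2 3) (column-below F E 3 5) (column-below F E 4 7)
      (column-decreasing F D 4 5 7 (column-below F E 4 7))
      (inj₂ (z , proj₁ (Occ-position-range o′ 0) , Occ-position-< o′ 0 1 , Occ-value-< o′ 3 0 , column-below F E 1 5))
    where F = Occ⇒Frame o′ refl refl

  j17⇒peak : ∀ js → DecOcc J17 π js → length js ≡ 6 → nonCircled J17 js ≡ IS → Peak
  j17⇒peak (_ ∷ x ∷ _ ∷ _ ∷ _ ∷ _ ∷ []) (o′ , E , D) refl refl =
    peak-at x (Occ-position-< o′ 0 1) (Occ-position-< o′ 1 2) (Occ-value-< o′ 3 1)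
      (column-below F E 1 3) (column-below F E 2 5)
      (column-decreasing F D 2 4 5 (column-below F E 2 5))
      (inj₁ (λ r 1≤r r<i1 → rows-empty F E 0 4 5 (1≤r , r<i1)))
    where F = Occ⇒Frame o′ refl refl

  j18⇒peak : ∀ js → DecOcc J18 π js → length js ≡ 7 → nonCircled J18 js ≡ IS → Peak
  j18⇒peak (z ∷ _ ∷ x ∷ _ ∷ _ ∷ _ ∷ _ ∷ []) (o′ , E , D) refl refl =
    peak-at x (Occ-position-< o′ 1 2) (Occ-position-< o′ 2 3) (Occ-value-< o′ 4 2)
      (column-below F E 2 3) (column-below F E 3 5)
      (column-decreasing F D 3 4 5 (column-below F E 3 5))
      (inj₂ (z , proj₁ (Occ-position-range o′ 0) , Occ-position-< o′ 0 1 , Occ-value-< o′ 2 0 , column-below F E 1 4))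
    where F = Occ⇒Frame o′ refl refl

  j19⇒peak : ∀ js → DecOcc J19 π js → length js ≡ 7 → nonCircled J19 js ≡ IS → Peak
  j19⇒peak (z ∷ _ ∷ x ∷ _ ∷ _ ∷ _ ∷ _ ∷ []) (o′ , E , D) refl refl =
    peak-at x (Occ-position-< o′ 1 2) (Occ-position-< o′ 2 3) (Occ-value-< o′ 4 2)
      (column-below F E 2 3) (column-below F E 3 5)
      (column-decreasing F D 3 4 5 (column-below F E 3 5))
      (inj₂ (z , proj₁ (Occ-position-range o′ 0) , Occ-position-< o′ 0 1 , Occ-value-< o′ 2 0 , column-below F E 1 4))
    where F = Occ⇒Frame o′ refl refl

  j110⇒peak : ∀ js → DecOcc J110 π js → length js ≡ 6 → nonCircled J110 js ≡ IS → Peak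
  j110⇒peak (_ ∷ x ∷ _ ∷ _ ∷ _ ∷ _ ∷ []) (o′ , E , D) refl refl =
    peak-at x (Occ-position-< o′ 0 1) (Occ-position-< o′ 1 2) (Occ-value-< o′ 3 1)
      (column-below F E 1 3) (column-below F E 2 6)
      (column-decreasing F D 2 4 6 (column-below F E 2 6))
      (inj₁ (λ r 1≤r r<i1 → rows-empty F E 0 4 6 (1≤r , r<i1)))
    where F = Occ⇒Frame o′ refl refl

  j111⇒peak : ∀ js → DecOcc J111 π js → length js ≡ 7 → nonCircled J111 js ≡ IS → Peak
  j111⇒peak (z ∷ _ ∷ x ∷ _ ∷ _ ∷ _ ∷ _ ∷ []) (o′ , E , D) refl refl =
    peak-at x (Occ-position-< o′ 1 2) (Occ-position-< o′ 2 3) (Occ-value-< o′ 4 2)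
      (column-below F E 2 3) (column-below F E 3 6)
      (column-decreasing F D 3 4 6 (column-below F E 3 6))
      (inj₂ (z , proj₁ (Occ-position-range o′ 0) , Occ-position-< o′ 0 1 , Occ-value-< o′ 2 0 , column-below F E 1 4))
    where F = Occ⇒Frame o′ refl refl

  RHS : Set
  RHS = ∃ λ k → 1 ≤ k × k ≤ 11 × ∃ λ js → DecOcc (J1 k) π js × map f (nonCircled (J1 k) js) ≡ map f IS

  pin : ∀ J {js} → DecOcc J π js → map f (nonCircled J js) ≡ map f IS → nonCircled J js ≡ IS
  pin J (o′ , _) = nonCircled-injective {J} o′ (Occ⇒positions o)

  RHS⇒noSeparator : RHS → NoSeparator
  RHS⇒noSeparator (1 , _ , _ , js , occ , eq) = below⇒noSeparator (j11⇒below js occ (Occ.len (proj₁ occ)) (pin J11 occ eq))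
  RHS⇒noSeparator (2 , _ , _ , js , occ , eq) = peak⇒noSeparator (j12⇒peak js occ (Occ.len (proj₁ occ)) (pin J12 occ eq))
  RHS⇒noSeparator (3 , _ , _ , js , occ , eq) = peak⇒noSeparator (j13⇒peak js occ (Occ.len (proj₁ occ)) (pin J13 occ eq))
  RHS⇒noSeparator (4 , _ , _ , js , occ , eq) = peak⇒noSeparator (j14⇒peak js occ (Occ.len (proj₁ occ)) (pin J14 occ eq))
  RHS⇒noSeparator (5 , _ , _ , js , occ , eq) = peak⇒noSeparator (j15⇒peak js occ (Occ.len (proj₁ occ)) (pin J15 occ eq))
  RHS⇒noSeparator (6 , _ , _ , js , occ , eq) = peak⇒noSeparator (j16⇒peak js occ (Occ.len (proj₁ occ)) (pin J16 occ eq))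
  RHS⇒noSeparator (7 , _ , _ , js , occ , eq) = peak⇒noSeparator (j17⇒peak js occ (Occ.len (proj₁ occ)) (pin J17 occ eq))
  RHS⇒noSeparator (8 , _ , _ , js , occ , eq) = peak⇒noSeparator (j18⇒peak js occ (Occ.len (proj₁ occ)) (pin J18 occ eq))
  RHS⇒noSeparator (9 , _ , _ , js , occ , eq) = peak⇒noSeparator (j19⇒peak js occ (Occ.len (proj₁ occ)) (pin J19 occ eq))
  RHS⇒noSeparator (10 , _ , _ , js , occ , eq) = peak⇒noSeparator (j110⇒peak js occ (Occ.len (proj₁ occ)) (pin J110 occ eq))
  RHS⇒noSeparator (11 , _ , _ , js , occ , eq) = peak⇒noSeparator (j111⇒peak js occ (Occ.len (proj₁ occ)) (pin J111 occ eq))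
  RHS⇒noSeparator (suc (suc (suc (suc (suc (suc (suc (suc (suc (suc (suc (suc k))))))))))) , _ , k≤11 , _) =
    ⊥-elim (<-irrefl refl (≤-trans (m≤m+n 12 k) k≤11))

  -- Occurrences of the J₁,ₖ from column conditions

  RHS-intro : ∀ k {_ : Holds (1 ≤? k)} {_ : Holds (k ≤? 11)} js → DecOcc (J1 k) π js → nonCircled (J1 k) js ≡ IS → RHS
  RHS-intro k {1≤k} {k≤11} js occ eq = k , toWitness 1≤k , toWitness k≤11 , js , occ , cong (map f) eq

  private
    0<i1 : 0 < i1
    0<i1 = proj₁ i1∈
    i5<top : i5 < suc n
    i5<top = s≤s (proj₂ i5∈)
    0<e : 0 < e
    0<e = proj₁ (f-range i5∈)
    <top : ∀ {t} → InRange n t → f t < suc n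
    <top t∈ = s≤s (proj₂ (f-range t∈))

  j11-occurrence : ∀ x → i1 < x → x < i2 → a < f x → f x < c → Below f i1 x a → Below f x i2 c → RHS
  j11-occurrence x i1<x x<i2 a<x x<c left right =
    RHS-intro 1 js (Frame⇒Occ (under J11) F refl refl , Empty-intro F ((1 , 3) ∷ (2 , 5) ∷ []) (left ∷ right ∷ []) , λ _ _ _ ()) refl
    where
    js = i1 ∷ x ∷ i2 ∷ i3 ∷ i4 ∷ i5 ∷ []
    F = Frame-intro (under J11) js (0<i1 ∷ i1<x ∷ x<i2 ∷ i2<i3 ∷ i3<i4 ∷ i4<i5 ∷ i5<top ∷ [-])
                                (0<e ∷ e<b ∷ b<a ∷ a<x ∷ x<c ∷ c<d ∷ <top i4∈ ∷ [-]) refl refl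

  j12-occurrence : ∀ x w → i1 < x → x < w → w < i2 → a < f x → f x < c → c < f w → f w < d →
                   Below f 0 i1 c → Below f i1 x a → Below f x w c → Below f w i2 (f w) → DecreasingAbove f w i2 c → RHS
  j12-occurrence x w i1<x x<w w<i2 a<x x<c c<w w<d col0 col1 col2 col3 decreasing =
    RHS-intro 2 js (Frame⇒Occ (under J12) F refl refl ,
                    Empty-intro F ((0 , 5) ∷ (1 , 3) ∷ (2 , 5) ∷ (3 , 6) ∷ []) (col0 ∷ col1 ∷ col2 ∷ col3 ∷ []) ,
                    Decreasing-intro F 3 5 decreasing) refl
    where
    js = i1 ∷ x ∷ w ∷ i2 ∷ i3 ∷ i4 ∷ i5 ∷ []
    F = Frame-intro (under J12) js (0<i1 ∷ i1<x ∷ x<w ∷ w<i2 ∷ i2<i3 ∷ i3<i4 ∷ i4<i5 ∷ i5<top ∷ [-])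
                                   (0<e ∷ e<b ∷ b<a ∷ a<x ∷ x<c ∷ c<w ∷ w<d ∷ <top i4∈ ∷ [-]) refl refl

  j13-occurrence : ∀ z x w → 1 ≤ z → z < i1 → i1 < x → x < w → w < i2 → a < f x → f x < c → c < f w → f w < f z → f z < d →
                   Below f z i1 c → Below f i1 x a → Below f x w c → Below f w i2 (f w) → DecreasingAbove f w i2 c → RHS
  j13-occurrence z x w 1≤z z<i1 i1<x x<w w<i2 a<x x<c c<w w<z z<d col1 col2 col3 col4 decreasing =
    RHS-intro 3 js (Frame⇒Occ (under J13) F refl refl ,
                    Empty-intro F ((1 , 5) ∷ (2 , 3) ∷ (3 , 5) ∷ (4 , 6) ∷ []) (col1 ∷ col2 ∷ col3 ∷ col4 ∷ []) ,
                    Decreasing-intro F 4 5 decreasing) refl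
    where
    js = z ∷ i1 ∷ x ∷ w ∷ i2 ∷ i3 ∷ i4 ∷ i5 ∷ []
    F = Frame-intro (under J13) js (1≤z ∷ z<i1 ∷ i1<x ∷ x<w ∷ w<i2 ∷ i2<i3 ∷ i3<i4 ∷ i4<i5 ∷ i5<top ∷ [-])
                                   (0<e ∷ e<b ∷ b<a ∷ a<x ∷ x<c ∷ c<w ∷ w<z ∷ z<d ∷ <top i4∈ ∷ [-]) refl refl

  j14-occurrence : ∀ z x w → 1 ≤ z → z < i1 → i1 < x → x < w → w < i2 → a < f x → f x < c → c < f w → f w < d → d < f z →
                   Below f z i1 c → Below f i1 x a → Below f x w c → Below f w i2 (f w) → DecreasingAbove f w i2 c → RHS
  j14-occurrence z x w 1≤z z<i1 i1<x x<w w<i2 a<x x<c c<w w<d d<z col1 col2 col3 col4 decreasing =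
    RHS-intro 4 js (Frame⇒Occ (under J14) F refl refl ,
                    Empty-intro F ((1 , 5) ∷ (2 , 3) ∷ (3 , 5) ∷ (4 , 6) ∷ []) (col1 ∷ col2 ∷ col3 ∷ col4 ∷ []) ,
                    Decreasing-intro F 4 5 decreasing) refl
    where
    js = z ∷ i1 ∷ x ∷ w ∷ i2 ∷ i3 ∷ i4 ∷ i5 ∷ []
    F = Frame-intro (under J14) js (1≤z ∷ z<i1 ∷ i1<x ∷ x<w ∷ w<i2 ∷ i2<i3 ∷ i3<i4 ∷ i4<i5 ∷ i5<top ∷ [-])
                                   (0<e ∷ e<b ∷ b<a ∷ a<x ∷ x<c ∷ c<w ∷ w<d ∷ d<z ∷ <top (left∈ 1≤z z<i1) ∷ [-]) refl refl

  j15-occurrence : ∀ x w → i1 < x → x < w → w < i2 → a < f x → f x < c → d < f w →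
                   Below f 0 i1 c → Below f i1 x a → Below f x w c → Below f w i2 (f w) → DecreasingAbove f w i2 c → RHS
  j15-occurrence x w i1<x x<w w<i2 a<x x<c d<w col0 col1 col2 col3 decreasing =
    RHS-intro 5 js (Frame⇒Occ (under J15) F refl refl ,
                    Empty-intro F ((0 , 5) ∷ (1 , 3) ∷ (2 , 5) ∷ (3 , 7) ∷ []) (col0 ∷ col1 ∷ col2 ∷ col3 ∷ []) ,
                    Decreasing-intro F 3 5 decreasing) refl
    where
    js = i1 ∷ x ∷ w ∷ i2 ∷ i3 ∷ i4 ∷ i5 ∷ []
    F = Frame-intro (under J15) js (0<i1 ∷ i1<x ∷ x<w ∷ w<i2 ∷ i2<i3 ∷ i3<i4 ∷ i4<i5 ∷ i5<top ∷ [-])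
                                   (0<e ∷ e<b ∷ b<a ∷ a<x ∷ x<c ∷ c<d ∷ d<w ∷ <top (middle∈ (<-trans i1<x x<w) w<i2) ∷ [-]) refl refl

  j16-occurrence : ∀ z x w → 1 ≤ z → z < i1 → i1 < x → x < w → w < i2 → a < f x → f x < c → d < f w → f w < f z →
                   Below f z i1 c → Below f i1 x a → Below f x w c → Below f w i2 (f w) → DecreasingAbove f w i2 c → RHS
  j16-occurrence z x w 1≤z z<i1 i1<x x<w w<i2 a<x x<c d<w w<z col1 col2 col3 col4 decreasing =
    RHS-intro 6 js (Frame⇒Occ (under J16) F refl refl ,
                    Empty-intro F ((1 , 5) ∷ (2 , 3) ∷ (3 , 5) ∷ (4 , 7) ∷ []) (col1 ∷ col2 ∷ col3 ∷ col4 ∷ []) ,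
                    Decreasing-intro F 4 5 decreasing) refl
    where
    js = z ∷ i1 ∷ x ∷ w ∷ i2 ∷ i3 ∷ i4 ∷ i5 ∷ []
    F = Frame-intro (under J16) js (1≤z ∷ z<i1 ∷ i1<x ∷ x<w ∷ w<i2 ∷ i2<i3 ∷ i3<i4 ∷ i4<i5 ∷ i5<top ∷ [-])
                                   (0<e ∷ e<b ∷ b<a ∷ a<x ∷ x<c ∷ c<d ∷ d<w ∷ w<z ∷ <top (left∈ 1≤z z<i1) ∷ [-]) refl refl

  j17-occurrence : ∀ x → i1 < x → x < i2 → c < f x → f x < d →
                   Below f 0 i1 c → Below f i1 x a → Below f x i2 (f x) → DecreasingAbove f x i2 c → RHS
  j17-occurrence x i1<x x<i2 c<x x<d col0 col1 col2 decreasing =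
    RHS-intro 7 js (Frame⇒Occ (under J17) F refl refl ,
                    Empty-intro F ((0 , 4) ∷ (1 , 3) ∷ (2 , 5) ∷ []) (col0 ∷ col1 ∷ col2 ∷ []) ,
                    Decreasing-intro F 2 4 decreasing) refl
    where
    js = i1 ∷ x ∷ i2 ∷ i3 ∷ i4 ∷ i5 ∷ []
    F = Frame-intro (under J17) js (0<i1 ∷ i1<x ∷ x<i2 ∷ i2<i3 ∷ i3<i4 ∷ i4<i5 ∷ i5<top ∷ [-])
                                   (0<e ∷ e<b ∷ b<a ∷ a<c ∷ c<x ∷ x<d ∷ <top i4∈ ∷ [-]) refl refl

  j18-occurrence : ∀ z x → 1 ≤ z → z < i1 → i1 < x → x < i2 → c < f x → f x < f z → f z < d →
                   Below f z i1 c → Below f i1 x a → Below f x i2 (f x) → DecreasingAbove f x i2 c → RHS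
  j18-occurrence z x 1≤z z<i1 i1<x x<i2 c<x x<z z<d col1 col2 col3 decreasing =
    RHS-intro 8 js (Frame⇒Occ (under J18) F refl refl ,
                    Empty-intro F ((1 , 4) ∷ (2 , 3) ∷ (3 , 5) ∷ []) (col1 ∷ col2 ∷ col3 ∷ []) ,
                    Decreasing-intro F 3 4 decreasing) refl
    where
    js = z ∷ i1 ∷ x ∷ i2 ∷ i3 ∷ i4 ∷ i5 ∷ []
    F = Frame-intro (under J18) js (1≤z ∷ z<i1 ∷ i1<x ∷ x<i2 ∷ i2<i3 ∷ i3<i4 ∷ i4<i5 ∷ i5<top ∷ [-])
                                   (0<e ∷ e<b ∷ b<a ∷ a<c ∷ c<x ∷ x<z ∷ z<d ∷ <top i4∈ ∷ [-]) refl refl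

  j19-occurrence : ∀ z x → 1 ≤ z → z < i1 → i1 < x → x < i2 → c < f x → f x < d → d < f z →
                   Below f z i1 c → Below f i1 x a → Below f x i2 (f x) → DecreasingAbove f x i2 c → RHS
  j19-occurrence z x 1≤z z<i1 i1<x x<i2 c<x x<d d<z col1 col2 col3 decreasing =
    RHS-intro 9 js (Frame⇒Occ (under J19) F refl refl ,
                    Empty-intro F ((1 , 4) ∷ (2 , 3) ∷ (3 , 5) ∷ []) (col1 ∷ col2 ∷ col3 ∷ []) ,
                    Decreasing-intro F 3 4 decreasing) refl
    where
    js = z ∷ i1 ∷ x ∷ i2 ∷ i3 ∷ i4 ∷ i5 ∷ []
    F = Frame-intro (under J19) js (1≤z ∷ z<i1 ∷ i1<x ∷ x<i2 ∷ i2<i3 ∷ i3<i4 ∷ i4<i5 ∷ i5<top ∷ [-])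
                                   (0<e ∷ e<b ∷ b<a ∷ a<c ∷ c<x ∷ x<d ∷ d<z ∷ <top (left∈ 1≤z z<i1) ∷ [-]) refl refl

  j110-occurrence : ∀ x → i1 < x → x < i2 → d < f x →
                    Below f 0 i1 c → Below f i1 x a → Below f x i2 (f x) → DecreasingAbove f x i2 c → RHS
  j110-occurrence x i1<x x<i2 d<x col0 col1 col2 decreasing =
    RHS-intro 10 js (Frame⇒Occ (under J110) F refl refl ,
                     Empty-intro F ((0 , 4) ∷ (1 , 3) ∷ (2 , 6) ∷ []) (col0 ∷ col1 ∷ col2 ∷ []) ,
                     Decreasing-intro F 2 4 decreasing) refl
    where
    js = i1 ∷ x ∷ i2 ∷ i3 ∷ i4 ∷ i5 ∷ []
    F = Frame-intro (under J110) js (0<i1 ∷ i1<x ∷ x<i2 ∷ i2<i3 ∷ i3<i4 ∷ i4<i5 ∷ i5<top ∷ [-])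
                                    (0<e ∷ e<b ∷ b<a ∷ a<c ∷ c<d ∷ d<x ∷ <top (middle∈ i1<x x<i2) ∷ [-]) refl refl

  j111-occurrence : ∀ z x → 1 ≤ z → z < i1 → i1 < x → x < i2 → d < f x → f x < f z →
                    Below f z i1 c → Below f i1 x a → Below f x i2 (f x) → DecreasingAbove f x i2 c → RHS
  j111-occurrence z x 1≤z z<i1 i1<x x<i2 d<x x<z col1 col2 col3 decreasing =
    RHS-intro 11 js (Frame⇒Occ (under J111) F refl refl ,
                     Empty-intro F ((1 , 4) ∷ (2 , 3) ∷ (3 , 6) ∷ []) (col1 ∷ col2 ∷ col3 ∷ []) ,
                     Decreasing-intro F 3 4 decreasing) refl
    where
    js = z ∷ i1 ∷ x ∷ i2 ∷ i3 ∷ i4 ∷ i5 ∷ []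
    F = Frame-intro (under J111) js (1≤z ∷ z<i1 ∷ i1<x ∷ x<i2 ∷ i2<i3 ∷ i3<i4 ∷ i4<i5 ∷ i5<top ∷ [-])
                                    (0<e ∷ e<b ∷ b<a ∷ a<c ∷ c<d ∷ d<x ∷ x<z ∷ <top (left∈ 1≤z z<i1) ∷ [-]) refl refl

  private
    ≯c⇒<c : ∀ {r} → 1 ≤ r → r < i1 → ¬ (c < f r) → f r < c
    ≯c⇒<c 1≤r r<i1 = f-≮⇒< (left∈ 1≤r r<i1) i3∈ (<⇒≢ (<-trans r<i1 (<-trans i1<i2 i2<i3)))

  LeftOfI1 : Set
  LeftOfI1 = Below f 0 i1 c ⊎ (∃ λ z → 1 ≤ z × z < i1 × c < f z × Below f z i1 c)

  left-of-i1 : LeftOfI1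
  left-of-i1 with Search.latest (λ r → c <? f r) 0 i1
  ... | inj₁ none = inj₁ (λ r 0<r r<i1 → ≯c⇒<c 0<r r<i1 (none r 0<r r<i1))
  ... | inj₂ (z , 0<z , z<i1 , c<z , max) =
    inj₂ (z , 0<z , z<i1 , c<z , λ r z<r r<i1 → ≯c⇒<c (<-≤-trans 0<z (<⇒≤ z<r)) r<i1 (max r z<r r<i1))

  module FromNoSeparator (noSep : NoSeparator) where

    private
      noLeft = proj₁ noSep
      noInside = proj₂ noSep

      ≢i3 : ∀ {r} → r < i2 → r ≢ i3
      ≢i3 r<i2 = <⇒≢ (<-trans r<i2 i2<i3)

      ≢i4 : ∀ {r} → r < i2 → r ≢ i4
      ≢i4 r<i2 = <⇒≢ (<-trans r<i2 (<-trans i2<i3 i3<i4))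

      below-a : ∀ x → x < i2 → (∀ r → i1 < r → r < x → ¬ (a < f r)) → Below f i1 x a
      below-a x x<i2 none r i1<r r<x = f-≮⇒< (middle∈ i1<r (<-trans r<x x<i2)) i1∈ (>⇒≢ i1<r) (none r i1<r r<x)

    after : ∀ w → i1 < w → w < i2 → c < f w → Below f w i2 (f w)
    after w i1<w w<i2 c<w r w<r r<i2 =
      f-≮⇒< (middle∈ (<-trans i1<w w<r) r<i2) (middle∈ i1<w w<i2) (>⇒≢ w<r)
            (λ w<r′ → noInside (w , r , i1<w , w<r , r<i2 , c<w , w<r′))

    decreasing : ∀ w → i1 < w → DecreasingAbove f w i2 c
    decreasing w i1<w r r′ w<r r<r′ r′<i2 c<r _ =
      f-≮⇒< (middle∈ (<-trans i1<w (<-trans w<r r<r′)) r′<i2) (middle∈ (<-trans i1<w w<r) (<-trans r<r′ r′<i2))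
            (>⇒≢ r<r′)
            (λ r<r′′ → noInside (r , r′ , <-trans i1<w w<r , r<r′ , r′<i2 , c<r , r<r′′))

    below-z : ∀ z w → 1 ≤ z → z < i1 → c < f z → Below f z i1 c → i1 < w → w < i2 → f w < f z
    below-z z w 1≤z z<i1 c<z z-below i1<w w<i2 =
      f-≮⇒< (middle∈ i1<w w<i2) (left∈ 1≤z z<i1) (λ w≡z → <-asym z<i1 (subst (i1 <_) w≡z i1<w))
            (λ z<w → noLeft (z , w , 1≤z , z<i1 , i1<w , w<i2 , c<z , z<w , λ r z<r r<i1 → <-trans (z-below r z<r r<i1) c<z))

    low : ∀ x → i1 < x → x < i2 → a < f x → f x < c → Below f i1 x a → RHS
    low x i1<x x<i2 a<x x<c col1 with Search.earliest (λ r → c <? f r) x i2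
    ... | inj₁ none = j11-occurrence x i1<x x<i2 a<x x<c col1
      (λ r x<r r<i2 → f-≮⇒< (middle∈ (<-trans i1<x x<r) r<i2) i3∈ (≢i3 r<i2) (none r x<r r<i2))
    ... | inj₂ (w , x<w , w<i2 , c<w , min) = with-peak left-of-i1 (f-<-or-> (middle∈ i1<w w<i2) i4∈ (≢i4 w<i2))
      where
      i1<w = <-trans i1<x x<w
      col2 : Below f x w c
      col2 r x<r r<w = f-≮⇒< (middle∈ (<-trans i1<x x<r) (<-trans r<w w<i2)) i3∈ (≢i3 (<-trans r<w w<i2)) (min r x<r r<w)
      with-peak : LeftOfI1 → f w < d ⊎ d < f w → RHS
      with-peak (inj₁ col0) (inj₁ w<d) =
        j12-occurrence x w i1<x x<w w<i2 a<x x<c c<w w<d col0 col1 col2 (after w i1<w w<i2 c<w) (decreasing w i1<w)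
      with-peak (inj₁ col0) (inj₂ d<w) =
        j15-occurrence x w i1<x x<w w<i2 a<x x<c d<w col0 col1 col2 (after w i1<w w<i2 c<w) (decreasing w i1<w)
      with-peak (inj₂ (z , 1≤z , z<i1 , c<z , z-col)) (inj₂ d<w) =
        j16-occurrence z x w 1≤z z<i1 i1<x x<w w<i2 a<x x<c d<w (below-z z w 1≤z z<i1 c<z z-col i1<w w<i2)
          z-col col1 col2 (after w i1<w w<i2 c<w) (decreasing w i1<w)
      with-peak (inj₂ (z , 1≤z , z<i1 , c<z , z-col)) (inj₁ w<d)
        with f-<-or-> (left∈ 1≤z z<i1) i4∈ (<⇒≢ (<-trans z<i1 (<-trans i1<i2 (<-trans i2<i3 i3<i4))))
      ... | inj₁ z<d = j13-occurrence z x w 1≤z z<i1 i1<x x<w w<i2 a<x x<c c<w (below-z z w 1≤z z<i1 c<z z-col i1<w w<i2) z<d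
                         z-col col1 col2 (after w i1<w w<i2 c<w) (decreasing w i1<w)
      ... | inj₂ d<z = j14-occurrence z x w 1≤z z<i1 i1<x x<w w<i2 a<x x<c c<w w<d d<z
                         z-col col1 col2 (after w i1<w w<i2 c<w) (decreasing w i1<w)

    high : ∀ x → i1 < x → x < i2 → c < f x → Below f i1 x a → RHS
    high x i1<x x<i2 c<x col1 = with-peak left-of-i1 (f-<-or-> (middle∈ i1<x x<i2) i4∈ (≢i4 x<i2))
      where
      col2 = after x i1<x x<i2 c<x
      with-peak : LeftOfI1 → f x < d ⊎ d < f x → RHS
      with-peak (inj₁ col0) (inj₁ x<d) = j17-occurrence x i1<x x<i2 c<x x<d col0 col1 col2 (decreasing x i1<x)
      with-peak (inj₁ col0) (inj₂ d<x) = j110-occurrence x i1<x x<i2 d<x col0 col1 col2 (decreasing x i1<x)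
      with-peak (inj₂ (z , 1≤z , z<i1 , c<z , z-col)) (inj₂ d<x) =
        j111-occurrence z x 1≤z z<i1 i1<x x<i2 d<x (below-z z x 1≤z z<i1 c<z z-col i1<x x<i2) z-col col1 col2 (decreasing x i1<x)
      with-peak (inj₂ (z , 1≤z , z<i1 , c<z , z-col)) (inj₁ x<d)
        with f-<-or-> (left∈ 1≤z z<i1) i4∈ (<⇒≢ (<-trans z<i1 (<-trans i1<i2 (<-trans i2<i3 i3<i4))))
      ... | inj₁ z<d = j18-occurrence z x 1≤z z<i1 i1<x x<i2 c<x (below-z z x 1≤z z<i1 c<z z-col i1<x x<i2) z<d
                         z-col col1 col2 (decreasing x i1<x)
      ... | inj₂ d<z = j19-occurrence z x 1≤z z<i1 i1<x x<i2 c<x x<d d<z z-col col1 col2 (decreasing x i1<x)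

    -- x is the first entry of (i1, i2) above a; it exists because of the marked box
    noSeparator⇒RHS : ∀ x₀ → i1 < x₀ → x₀ < i2 → a < f x₀ → RHS
    noSeparator⇒RHS x₀ i1<x₀ x₀<i2 a<x₀ with Search.earliest (λ r → a <? f r) i1 i2
    ... | inj₁ none = ⊥-elim (none x₀ i1<x₀ x₀<i2 a<x₀)
    ... | inj₂ (x , i1<x , x<i2 , a<x , min) with f-<-or-> (middle∈ i1<x x<i2) i3∈ (≢i3 x<i2)
    ...   | inj₁ x<c = low x i1<x x<i2 a<x x<c (below-a x x<i2 min)
    ...   | inj₂ c<x = high x i1<x x<i2 c<x (below-a x x<i2 min)

  -- The pattern W₂ in S(π)

  σ : List ℕ
  σ = S π

  σ↭π : σ ↭ π
  σ↭π = S-↭ π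

  Uσ : Unique σ
  Uσ = Setoid↭.Unique-resp-↭ (setoid ℕ) (↭⇒↭ₛ (↭-sym σ↭π)) Uπ

  σ-range : ∀ {y} → y ∈ σ → InRange (length σ) y
  σ-range y∈ = subst (λ m → InRange m _) (sym (↭-length σ↭π)) (range (∈-resp-↭ σ↭π y∈))

  module Sorted = Permutation σ Uσ σ-range

  g : ℕ → ℕ
  g = at σ

  N : ℕ
  N = length σ

  LHS : Set
  LHS = ∃ λ js → MeshOcc W2 W2shaded σ js × map g js ↭ E π IS

  precedes : ∀ {u v} → u ∈ π → v ∈ π → Precedes π u v → Before σ u v
  precedes = Precedes⇒Before-S Uπ

  σ-position : ∀ {t} → InRange n t → ∃ λ s → InRange N s × g s ≡ f t
  σ-position t∈ = Sorted.∈⇒f (∈-resp-↭ (↭-sym σ↭π) (f-∈ t∈))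

  π-position : ∀ {s} → InRange N s → ∃ λ t → InRange n t × f t ≡ g s
  π-position s∈ = ∈⇒f (∈-resp-↭ σ↭π (Sorted.f-∈ s∈))

  b-precedes : ∀ {p} → InRange n p → p < i2 → b < f p → Below f p i2 (f p) → Before σ b (f p)
  b-precedes p∈ p<i2 b<p below =
    precedes (f-∈ i2∈) (f-∈ p∈) (inj₂ (f-before p∈ p<i2 i2∈ , b<p , between-below p∈ i2∈ below))

  high-not-between : NoSeparator → ∀ p → InRange n p → c < f p → Before σ a (f p) → Before σ (f p) b → ⊥
  high-not-between (noLeft , noInside) p p∈ c<p a≺p p≺b with <-cmp p i2
  ... | tri≈ _ refl _ = <-asym c<p (<-trans b<a a<c)
  ... | tri> _ _ i2<p =
    before-asym Uσ p≺b (precedes (f-∈ i2∈) (f-∈ p∈) (inj₁ (f-before i2∈ i2<p p∈ , inj₁ (<-trans (<-trans b<a a<c) c<p))))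
  ... | tri< p<i2 _ _ with <-cmp p i1
  ...   | tri≈ _ refl _ = <-asym c<p a<c
  ...   | tri> _ _ i1<p with Search.earliest (λ r → f p <? f r) p i2
  ...     | inj₂ (r , p<r , r<i2 , p<r′ , _) = noInside (p , r , i1<p , p<r , r<i2 , c<p , p<r′)
  ...     | inj₁ none =
    before-asym Uσ p≺b (b-precedes p∈ p<i2 (<-trans (<-trans b<a a<c) c<p)
      (λ r p<r r<i2 → f-≮⇒< (middle∈ (<-trans i1<p p<r) r<i2) p∈ (>⇒≢ p<r) (none r p<r r<i2)))
  high-not-between (noLeft , noInside) p p∈ c<p a≺p p≺b | tri< p<i2 _ _ | tri< p<i1 _ _
    with Search.earliest (λ r → f p <? f r) p i1
  ... | inj₂ (r , p<r , r<i1 , p<r′ , _) =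
    before-asym Uσ a≺p (precedes (f-∈ p∈) (f-∈ i1∈) (inj₁ (f-before p∈ p<i1 i1∈ , inj₂ (f r , f-between p∈ p<r r<i1 i1∈ , p<r′))))
  ... | inj₁ none-left with Search.earliest (λ r → f p <? f r) i1 i2
  ...   | inj₂ (q , i1<q , q<i2 , p<q , _) = noLeft (p , q , proj₁ p∈ , p<i1 , i1<q , q<i2 , c<p , p<q , below-left)
    where
    below-left : Below f p i1 (f p)
    below-left r p<r r<i1 = f-≮⇒< (range-≤ (≤-trans (proj₁ p∈) (<⇒≤ p<r)) (<⇒≤ r<i1) i1∈) p∈ (>⇒≢ p<r) (none-left r p<r r<i1)
  ...   | inj₁ none-middle = before-asym Uσ p≺b (b-precedes p∈ p<i2 (<-trans (<-trans b<a a<c) c<p) below)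
    where
    below : Below f p i2 (f p)
    below r p<r r<i2 with <-cmp r i1
    ... | tri< r<i1 _ _ = f-≮⇒< (range-≤ (≤-trans (proj₁ p∈) (<⇒≤ p<r)) (<⇒≤ r<i1) i1∈) p∈ (>⇒≢ p<r) (none-left r p<r r<i1)
    ... | tri≈ _ refl _ = <-trans a<c c<p
    ... | tri> _ _ i1<r = f-≮⇒< (middle∈ i1<r r<i2) p∈ (>⇒≢ p<r) (none-middle r i1<r r<i2)

  W2-occurrence⇒noSeparator : ∀ js → Occ W2 σ js → Empty σ js W2shaded → length js ≡ 4 → map g js ↭ E π IS → NoSeparator
  W2-occurrence⇒noSeparator (s1 ∷ s2 ∷ s3 ∷ s4 ∷ []) oW emptyW refl values↭ = noLeft , noInside
    where
    F = Sorted.Occ⇒Frame oW refl refl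
    sorted≡ : g s4 ∷ g s2 ∷ g s1 ∷ g s3 ∷ [] ≡ e ∷ b ∷ a ∷ c ∷ []
    sorted≡ = ascending-≡ (Occ-value-< oW 3 1 ∷ Occ-value-< oW 1 0 ∷ Occ-value-< oW 0 2 ∷ [-]) (e<b ∷ b<a ∷ a<c ∷ [-])
                (λ z∈ → ∈-resp-↭ ↭-by-rank-3241 (∈-resp-↭ values↭ (∈-resp-↭ (↭-sym ↭-by-rank-3241) z∈)))
                (λ z∈ → ∈-resp-↭ ↭-by-rank-3241 (∈-resp-↭ (↭-sym values↭) (∈-resp-↭ (↭-sym ↭-by-rank-3241) z∈)))
    g1 : g s1 ≡ a
    g1 = proj₁ (∷-injective (proj₂ (∷-injective (proj₂ (∷-injective sorted≡)))))
    g2 : g s2 ≡ b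
    g2 = proj₁ (∷-injective (proj₂ (∷-injective sorted≡)))
    g3 : g s3 ≡ c
    g3 = proj₁ (∷-injective (proj₂ (∷-injective (proj₂ (∷-injective (proj₂ (∷-injective sorted≡)))))))
    between : ∀ p → InRange n p → c < f p → Before σ a (f p) → Before σ (f p) b → ⊥
    between p p∈ c<p a≺p p≺b with σ-position p∈
    ... | t , t∈ , gt≡ =
      Sorted.rows-empty F emptyW 1 4 5
        (Sorted.before⇒< (Occ-position-range oW 0) t∈ (subst₂ (Before σ) (sym g1) (sym gt≡) a≺p) ,
         Sorted.before⇒< t∈ (Occ-position-range oW 1) (subst₂ (Before σ) (sym gt≡) (sym g2) p≺b))
        (subst₂ _<_ (sym g3) (sym gt≡) c<p) (s≤s (proj₂ (Sorted.f-range t∈)))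
    noLeft : ¬ SeparatorLeft
    noLeft (p , q , 1≤p , p<i1 , i1<q , q<i2 , c<p , p<q , p-above) = between p p∈ c<p a≺p p≺b
      where
      p∈ = left∈ 1≤p p<i1
      a≺p = precedes (f-∈ i1∈) (f-∈ p∈) (inj₂ (f-before p∈ p<i1 i1∈ , <-trans a<c c<p , between-below p∈ i1∈ p-above))
      p≺b = precedes (f-∈ p∈) (f-∈ i2∈)
              (inj₁ (f-before p∈ (<-trans p<i1 i1<i2) i2∈ , inj₂ (f q , f-between p∈ (<-trans p<i1 i1<q) q<i2 i2∈ , p<q)))
    noInside : ¬ SeparatorInside
    noInside (p , q , i1<p , p<q , q<i2 , c<p , p<q′) = between p p∈ c<p a≺p p≺b
      where
      p∈ = middle∈ i1<p (<-trans p<q q<i2)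
      a≺p = precedes (f-∈ i1∈) (f-∈ p∈) (inj₁ (f-before i1∈ i1<p p∈ , inj₁ (<-trans a<c c<p)))
      p≺b = precedes (f-∈ p∈) (f-∈ i2∈)
              (inj₁ (f-before p∈ (<-trans p<q q<i2) i2∈ , inj₂ (f q , f-between p∈ p<q q<i2 i2∈ , p<q′)))

  LHS⇒noSeparator : LHS → NoSeparator
  LHS⇒noSeparator (js , (oW , emptyW) , values↭) = W2-occurrence⇒noSeparator js oW emptyW (Occ.len oW) values↭

  noSeparator⇒LHS : ∀ x₀ → i1 < x₀ → x₀ < i2 → a < f x₀ → NoSeparator → LHS
  noSeparator⇒LHS x₀ i1<x₀ x₀<i2 a<x₀ noSep with σ-position i1∈ | σ-position i2∈ | σ-position i3∈ | σ-position i5∈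
  ... | sa , sa∈ , ga | sb , sb∈ , gb | sc , sc∈ , gc | se , se∈ , ge =
    js , (Sorted.Frame⇒Occ W2 F refl refl , Sorted.Empty-intro F ((1 , 4) ∷ []) (gap-below-c ∷ [])) ,
    ↭-reflexive (cong₂ _∷_ ga (cong₂ _∷_ gb (cong₂ _∷_ gc (cong₂ _∷_ ge refl))))
    where
    js = sa ∷ sb ∷ sc ∷ se ∷ []
    a≺b : Before σ a b
    a≺b = precedes (f-∈ i1∈) (f-∈ i2∈) (inj₁ (f-before i1∈ i1<i2 i2∈ , inj₂ (f x₀ , f-between i1∈ i1<x₀ x₀<i2 i2∈ , a<x₀)))
    b≺c : Before σ b c
    b≺c = precedes (f-∈ i2∈) (f-∈ i3∈) (inj₁ (f-before i2∈ i2<i3 i3∈ , inj₁ (<-trans b<a a<c)))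
    c≺e : Before σ c e
    c≺e = precedes (f-∈ i3∈) (f-∈ i5∈) (inj₁ (f-before i3∈ (<-trans i3<i4 i4<i5) i5∈ , inj₂ (d , f-between i3∈ i3<i4 i4<i5 i5∈ , c<d)))
    position-< : ∀ {s t u v} → InRange N s → g s ≡ u → InRange N t → g t ≡ v → Before σ u v → s < t
    position-< s∈ refl t∈ refl = Sorted.before⇒< s∈ t∈
    sa<sb = position-< sa∈ ga sb∈ gb a≺b
    sb<sc = position-< sb∈ gb sc∈ gc b≺c
    F = Sorted.Frame-intro W2 js (proj₁ sa∈ ∷ sa<sb ∷ sb<sc ∷ position-< sc∈ gc se∈ ge c≺e ∷ s≤s (proj₂ se∈) ∷ [-])
          (proj₁ (Sorted.f-range se∈) ∷ subst₂ _<_ (sym ge) (sym gb) e<b ∷ subst₂ _<_ (sym gb) (sym ga) b<a ∷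
           subst₂ _<_ (sym ga) (sym gc) a<c ∷ s≤s (proj₂ (Sorted.f-range sc∈)) ∷ [-]) refl refl
    gap-below-c : Below g sa sb (g sc)
    gap-below-c t sa<t t<sb with π-position (Sorted.range-≤ (≤-trans (proj₁ sa∈) (<⇒≤ sa<t)) (<⇒≤ t<sb) sb∈)
    ... | p , p∈ , fp≡gt =
      Sorted.f-≮⇒< t∈ sc∈ (λ t≡sc → <-asym (subst (_< sb) t≡sc t<sb) sb<sc)
        (λ sc<t → high-not-between noSep p p∈ (subst₂ _<_ gc (sym fp≡gt) sc<t)
                   (subst₂ (Before σ) ga (sym fp≡gt) (Sorted.f-before sa∈ sa<t t∈))
                   (subst₂ (Before σ) (sym fp≡gt) gb (Sorted.f-before t∈ t<sb sb∈)))
      where t∈ = Sorted.range-≤ (≤-trans (proj₁ sa∈) (<⇒≤ sa<t)) (<⇒≤ t<sb) sb∈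

  private
    j1-frame : Frame IS (withSentinels (sortedValues j1 IS) n)
    j1-frame = Occ⇒Frame o refl refl

  marked-entry : ∀ {t} → InUnion π IS j1marked t → i1 < t × t < i2 × a < f t
  marked-entry (here box@(i1<t , t<i2 , _)) =
    i1<t , t<i2 , proj₁ (box-value j1-frame {a = 1} box)
  marked-entry (there (here box@(i1<t , t<i2 , _))) =
    i1<t , t<i2 , <-trans a<c (proj₁ (box-value j1-frame {a = 1} box))
  marked-entry (there (there (here box@(i1<t , t<i2 , _)))) =
    i1<t , t<i2 , <-trans (<-trans a<c c<d) (proj₁ (box-value j1-frame {a = 1} box))

  LHS⇔RHS : ∀ {t} → InUnion π IS j1marked t → LHS ⇔ RHS
  LHS⇔RHS marked with marked-entry marked
  ... | i1<x₀ , x₀<i2 , a<x₀ =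
    mk⇔ (λ lhs → FromNoSeparator.noSeparator⇒RHS (LHS⇒noSeparator lhs) _ i1<x₀ x₀<i2 a<x₀)
        (λ rhs → noSeparator⇒LHS _ i1<x₀ x₀<i2 a<x₀ (RHS⇒noSeparator rhs))

permutation-unique : ∀ {π} → π ↭ map suc (upTo (length π)) → Unique π
permutation-unique perm =
  Setoid↭.Unique-resp-↭ (setoid ℕ) (↭⇒↭ₛ (↭-sym perm)) (Unique.map⁺ suc-injective (Unique.upTo⁺ _))

permutation-range : ∀ {π} → π ↭ map suc (upTo (length π)) → ∀ {y} → y ∈ π → InRange (length π) y
permutation-range perm y∈ with ∈-map⁻ suc (∈-resp-↭ perm y∈)
... | k , k∈ , refl = s≤s z≤n , ∈-upTo⁻ k∈

proposition3p5 : (π is : List ℕ) →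
  π ↭ map suc (upTo (length π)) →
  MarkedMeshOcc j1 j1shaded j1marked π is →
  (∃ (λ js → MeshOcc W2 W2shaded (S π) js × (map (at (S π)) js ↭ E π is)))
    ⇔
  (∃ (λ k → (1 ≤ k) × (k ≤ 11) ×
    ∃ (λ js → DecOcc (J1 k) π js × (map (at π) (nonCircled (J1 k) js) ≡ map (at π) is))))
proposition3p5 π is perm (o , _ , _ , marked) = equivalence is o (Occ.len o) marked
  where
  equivalence : ∀ is → Occ j1 π is → length is ≡ 5 → ∀ {t} → InUnion π is j1marked t →
    (∃ (λ js → MeshOcc W2 W2shaded (S π) js × (map (at (S π)) js ↭ E π is))) ⇔
    (∃ (λ k → (1 ≤ k) × (k ≤ 11) × ∃ (λ js → DecOcc (J1 k) π js × (map (at π) (nonCircled (J1 k) js) ≡ map (at π) is))))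
  equivalence (i1 ∷ i2 ∷ i3 ∷ i4 ∷ i5 ∷ []) o refl =
    J1Occurrence.LHS⇔RHS π (permutation-unique perm) (permutation-range perm) i1 i2 i3 i4 i5 o
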